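{- Let $G=\{g_1:=0,g_2,\ldots,g_n\}$ be a finite Abelian group of even order $n\ge 4$ which is not isomorphic to $(\mathbb{Z}/2\mathbb{Z})^\nu$ for any $\nu$, and let $$L_G=\Big\{{\boldsymbol x}=(x_1,\ldots,x_n)\in\mathbb{Z}^n:\ \sum_{i=1}^n x_i=0,\ \sum_{j=2}^n x_j g_j=0\Big\}.$$ Then $L_G$ is not strongly eutactic.
   Context: For a lattice $\Lambda$ let $|\Lambda|$ be its minimal nonzero Euclidean norm and $S(\Lambda)$ its set of vectors of norm $|\Lambda|$. $\Lambda$ is strongly eutactic (in $V=\operatorname{span}_{\mathbb R}\Lambda$) if $\frac{1}{|\Lambda|}S(\Lambda)$ is a spherical $2$-design in $V$, i.e. the average over the unit sphere of $V$ of every real polynomial of degree $\le 2$ equals its average over this finite set; equivalently, $\sum_{{\boldsymbol x}\in S(\Lambda)}({\boldsymbol x},{\boldsymbol y})^2=\frac{|\Lambda|^2|S(\Lambda)|}{\dim V}({\boldsymbol y},{\boldsymbol y})$ for all ${\boldsymbol y}\in V$. -}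

module Defs where

open import Level using (Level; _⊔_)
open import Algebra.Bundles using (AbelianGroup)
open import Data.Nat as ℕ using (ℕ; zero; suc)
open import Data.Integer as ℤ using (ℤ; +_; -[1+_])
open import Data.Fin using (Fin; zero; suc)
open import Data.List as List using (List; length)
open import Data.List.Relation.Unary.Unique.Propositional using (Unique)
open import Data.List.Membership.Propositional using (_∈_)
open import Data.Vec as Vec using (Vec; lookup; zipWith)
open import Data.Bool using (Bool; _xor_)
open import Data.Product using (Σ; ∃; _×_; _,_)
open import Function.Bundles using (_⇔_)
open import Relation.Binary.PropositionalEquality using (_≡_)
open import Relation.Nullary using (¬_)

ZVec : ℕ → Set
ZVec n = Vec ℤ n

sumV : ∀ {n} → Vec ℤ n → ℤ
sumV Vec.[] = + 0
sumV (x Vec.∷ xs) = x ℤ.+ sumV xs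

sumL : List ℤ → ℤ
sumL List.[] = + 0
sumL (x List.∷ xs) = x ℤ.+ sumL xs

dot : ∀ {n} → ZVec n → ZVec n → ℤ
dot x y = sumV (zipWith ℤ._*_ x y)

norm² : ∀ {n} → ZVec n → ℤ
norm² x = dot x x

IsZeroVec : ∀ {n} → ZVec n → Set
IsZeroVec x = ∀ i → lookup x i ≡ + 0

module _ {ℓ : Level} {n : ℕ} (L : ZVec n → Set ℓ) where

  IsMinNorm² : ℤ → Set ℓ
  IsMinNorm² m =
    (∃ λ x → L x × ¬ IsZeroVec x × norm² x ≡ m) ×
    (∀ x → L x → ¬ IsZeroVec x → m ℤ.≤ norm² x)

  IsMinVec : ℤ → ZVec n → Set ℓ
  IsMinVec m x = L x × ¬ IsZeroVec x × norm² x ≡ m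

  EnumeratesMinVecs : ℤ → List (ZVec n) → Set ℓ
  EnumeratesMinVecs m S = Unique S × (∀ x → (x ∈ S) ⇔ IsMinVec m x)

  -- Strong eutaxy: S(Λ)/|Λ| is a spherical 2-design in V, i.e.
  --   Σ_{x∈S} (x,y)² = |Λ|² |S| / dim V · (y,y)   for all y ∈ V,
  -- written without division, for y ranging over the integer points of V
  -- (V is given by a predicate, d = dim V).
  StronglyEutactic : (V : ZVec n → Set) (d : ℕ) → Set ℓ
  StronglyEutactic V d =
    Σ ℤ λ m → Σ (List (ZVec n)) λ S →
      IsMinNorm² m × EnumeratesMinVecs m S ×
      (∀ y → V y →
        (+ d) ℤ.* sumL (List.map (λ x → dot x y ℤ.* dot x y) S)
          ≡ m ℤ.* (+ length S) ℤ.* dot y y)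

SumZero : ∀ {n} → ZVec n → Set
SumZero x = sumV x ≡ + 0

module _ {c ℓ : Level} (G : AbelianGroup c ℓ) where
  open AbelianGroup G

  natMul : ℕ → Carrier → Carrier
  natMul zero a = ε
  natMul (suc k) a = a ∙ natMul k a

  intMul : ℤ → Carrier → Carrier
  intMul (+ k) a = natMul k a
  intMul -[1+ k ] a = (natMul (suc k) a) ⁻¹

  gsum : ∀ {k} → (Fin k → Carrier) → Carrier
  gsum {zero} f = ε
  gsum {suc k} f = f zero ∙ gsum (λ i → f (suc i))

  IsEnumeration : ∀ {n} → (Fin n → Carrier) → Set (c ⊔ ℓ)
  IsEnumeration g =
    (∀ i j → g i ≈ g j → i ≡ j) × (∀ a → ∃ λ i → g i ≈ a)

  -- G ≅ (ℤ/2ℤ)^ν, with (ℤ/2ℤ)^ν = (Vec Bool ν, pointwise xor)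
  IsoToZ2Pow : ℕ → Set (c ⊔ ℓ)
  IsoToZ2Pow ν = Σ (Carrier → Vec Bool ν) λ f →
    (∀ a b → a ≈ b → f a ≡ f b) ×
    (∀ a b → f (a ∙ b) ≡ zipWith _xor_ (f a) (f b)) ×
    (∀ a b → f a ≡ f b → a ≈ b) ×
    (∀ v → ∃ λ a → f a ≡ v)

  -- L_G for the enumeration g_1,…,g_n (n = suc m), coordinates x_1..x_n
  InLG : ∀ {m} → (Fin (suc m) → Carrier) → ZVec (suc m) → Set ℓ
  InLG g x =
    (sumV x ≡ + 0) ×
    (gsum (λ j → intMul (lookup x (suc j)) (g (suc j))) ≈ ε)

{-# OPTIONS --safe #-}
module Submission where

-- A nonzero x ∈ L_G with |x|² ≤ 4 is e_a + e_b − e_c − e_d with a, b, c, d distinct and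
-- g_a + g_b = g_c + g_d, since e_a − e_c would force g_a = g_c.  Such quadruples exist: |G| is even, so G has an
-- element h of order 2, and G is not elementary abelian, so 2a ≠ 0 for some a; take (0, a + h, h, a).  Hence
-- |L_G|² = 4 and S(L_G) consists of these vectors, each coming from exactly four ordered quadruples.
-- Testing strong eutaxy on y = e_t − e_i shows that Σ_{x∈S} x_i² does not depend on i, and then that
-- Σ_{x∈S} x_t x_0 is the same for all t ≠ 0.  Counting quadruples, this sum is 4 − n − ρ(t) − 2[2t = 0], where
-- ρ(t) (#roots t below) is the number of c with 2c = t; so ρ(t) = ρ(h) + 2 whenever 2t ≠ 0.  Since ρ(t) is 0 or
-- ρ(0), both a and a + h are doubles, hence so is h, and then ρ(0) = ρ(a) = ρ(h) + 2 = ρ(0) + 2.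
-- The group laws are written multiplicatively below: 2c = t reads c ∙ c ≡ t.

open import Defs
open import Algebra.Bundles using (AbelianGroup)
open import Algebra.Core using (Op₁; Op₂)
open import Algebra.Structures using (IsAbelianGroup)
open import Data.Bool using (Bool; true; false; if_then_else_; _xor_)
open import Data.Empty using (⊥-elim)
open import Data.Fin as Fin using (Fin; zero; suc; _≟_)
open import Data.Fin.Permutation using (Permutation; permutation)
open import Data.Fin.Properties using (any?; all?; ¬∀⟶∃¬; <-cmp; _<?_; <-irrefl; injective⇒≤)
open import Data.Integer using (ℤ; +_; -[1+_]; 0ℤ; 1ℤ; -1ℤ; _+_; _-_; -_; _*_; _≤_; _<_; +≤+; +<+)
  renaming (_⊖_ to _⊖ℕ_)
import Data.Integer.Properties as ℤ
open import Data.Integer.Solver using (module +-*-Solver)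
open import Data.List as List using (List; []; _∷_; length)
open import Data.List.Membership.Propositional.Properties using (∈-lookup)
open import Data.List.Relation.Unary.All as All using ()
open import Data.List.Relation.Unary.AllPairs using (_∷_)
open import Data.List.Relation.Unary.Any as Any using ()
open import Data.List.Relation.Unary.Any.Properties using (lookup-index)
open import Data.List.Relation.Unary.Unique.Propositional using (Unique)
open import Data.Nat as ℕ using (ℕ; zero; suc; z≤n; s≤s)
open import Data.Nat.Divisibility using (_∣_; divides)
import Data.Nat.Properties as ℕ
open import Data.Product using (Σ; ∃; _×_; _,_; proj₁; proj₂)
open import Data.Sum using (_⊎_; inj₁; inj₂)
open import Data.Vec using (Vec; []; _∷_; lookup; tabulate; zipWith)
open import Data.Vec.Properties using (lookup∘tabulate; tabulate∘lookup; tabulate-cong) renaming (≡-dec to ≡-decᵥ)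
open import Function using (_∘_; case_of_)
open import Function.Bundles using (Equivalence)
open import Level using (0ℓ)
open import Relation.Binary.Definitions using (tri<; tri≈; tri>)
open import Relation.Binary.PropositionalEquality
  using (_≡_; _≢_; refl; sym; trans; cong; cong₂; subst; subst₂; isEquivalence; module ≡-Reasoning)
open import Relation.Nullary using (Dec; yes; no; does; ¬_)
open import Relation.Nullary.Decidable using (_×-dec_; _⊎-dec_; ¬?; map′; decidable-stable)

open import Algebra.Properties.Semiring.Sum ℤ.+-*-semiring
  using (sum; sum-cong-≗; sum-replicate-zero; ∑-distrib-+; ∑-comm; ∑-permute; *-distribˡ-sum; *-distribʳ-sum)
open import Algebra.Properties.CommutativeSemigroup ℤ.+-commutativeSemigroup using (x∙yz≈y∙xz)
open import Algebra.Properties.AbelianGroup ℤ.+-0-abelianGroup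
  using () renaming (∙-cancelˡ to +-cancelˡ-≡; ∙-cancelʳ to +-cancelʳ-≡; identityʳ-unique to +-identityʳ-unique)
open +-*-Solver using (solve; _:=_; _:+_; _:-_; _:*_; :-_; con)

-- Iverson brackets and sums over Fin n

⟦_⟧ : ∀ {a} {A : Set a} → Dec A → ℤ
⟦ d ⟧ = if does d then 1ℤ else 0ℤ

⟦yes⟧ : ∀ {a} {A : Set a} (d : Dec A) → A → ⟦ d ⟧ ≡ 1ℤ
⟦yes⟧ (yes _) _ = refl
⟦yes⟧ (no ¬p) p = ⊥-elim (¬p p)

⟦no⟧ : ∀ {a} {A : Set a} (d : Dec A) → ¬ A → ⟦ d ⟧ ≡ 0ℤ
⟦no⟧ (yes p) ¬p = ⊥-elim (¬p p)
⟦no⟧ (no _) _ = refl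

⟦⟧-nonneg : ∀ {a} {A : Set a} (d : Dec A) → 0ℤ ≤ ⟦ d ⟧
⟦⟧-nonneg (yes _) = +≤+ z≤n
⟦⟧-nonneg (no _) = +≤+ z≤n

⟦⟧-cong : ∀ {a b} {A : Set a} {B : Set b} (A? : Dec A) (B? : Dec B) → (A → B) → (B → A) → ⟦ A? ⟧ ≡ ⟦ B? ⟧
⟦⟧-cong (yes _) (yes _) _ _ = refl
⟦⟧-cong (yes p) (no ¬q) f _ = ⊥-elim (¬q (f p))
⟦⟧-cong (no ¬p) (yes q) _ g = ⊥-elim (¬p (g q))
⟦⟧-cong (no _) (no _) _ _ = refl

⟦×⟧ : ∀ {a b} {A : Set a} {B : Set b} (A? : Dec A) (B? : Dec B) → ⟦ A? ⟧ * ⟦ B? ⟧ ≡ ⟦ A? ×-dec B? ⟧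
⟦×⟧ (yes _) (yes _) = refl
⟦×⟧ (yes _) (no _) = refl
⟦×⟧ (no _) (yes _) = refl
⟦×⟧ (no _) (no _) = refl

⟦⊎⟧ : ∀ {a b} {A : Set a} {B : Set b} (A? : Dec A) (B? : Dec B) → (A → ¬ B) →
      ⟦ A? ⟧ + ⟦ B? ⟧ ≡ ⟦ A? ⊎-dec B? ⟧
⟦⊎⟧ (yes p) (yes q) A∩B=∅ = ⊥-elim (A∩B=∅ p q)
⟦⊎⟧ (yes _) (no _) _ = refl
⟦⊎⟧ (no _) (yes _) _ = refl
⟦⊎⟧ (no _) (no _) _ = refl

⟦none-of-2⟧ : ∀ {a b} {A : Set a} {B : Set b} (A? : Dec A) (B? : Dec B) → (A → ¬ B) →
  ⟦ ¬? A? ×-dec ¬? B? ⟧ ≡ 1ℤ - ⟦ A? ⟧ - ⟦ B? ⟧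
⟦none-of-2⟧ (yes p) (yes q) A∩B=∅ = ⊥-elim (A∩B=∅ p q)
⟦none-of-2⟧ (yes _) (no _) _ = refl
⟦none-of-2⟧ (no _) (yes _) _ = refl
⟦none-of-2⟧ (no _) (no _) _ = refl

⟦none-of-3⟧ : ∀ {a b c} {A : Set a} {B : Set b} {C : Set c} (A? : Dec A) (B? : Dec B) (C? : Dec C) →
  (A → ¬ B) → (A → ¬ C) → (B → ¬ C) →
  ⟦ ¬? A? ×-dec ¬? B? ×-dec ¬? C? ⟧ ≡ 1ℤ - ⟦ A? ⟧ - ⟦ B? ⟧ - ⟦ C? ⟧
⟦none-of-3⟧ (yes p) (yes q) _ A∩B=∅ _ _ = ⊥-elim (A∩B=∅ p q)
⟦none-of-3⟧ (yes p) (no _) (yes r) _ A∩C=∅ _ = ⊥-elim (A∩C=∅ p r)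
⟦none-of-3⟧ (no _) (yes q) (yes r) _ _ B∩C=∅ = ⊥-elim (B∩C=∅ q r)
⟦none-of-3⟧ (yes _) (no _) (no _) _ _ _ = refl
⟦none-of-3⟧ (no _) (yes _) (no _) _ _ _ = refl
⟦none-of-3⟧ (no _) (no _) (yes _) _ _ _ = refl
⟦none-of-3⟧ (no _) (no _) (no _) _ _ _ = refl

δ : ∀ {n} → Fin n → Fin n → ℤ
δ a i = ⟦ i ≟ a ⟧

δ-diag : ∀ {n} (a : Fin n) → δ a a ≡ 1ℤ
δ-diag a = ⟦yes⟧ (a ≟ a) refl

δ-off : ∀ {n} {a i : Fin n} → i ≢ a → δ a i ≡ 0ℤ
δ-off {a = a} {i} = ⟦no⟧ (i ≟ a)

δ-sym : ∀ {n} (a i : Fin n) → δ a i ≡ δ i a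
δ-sym a i = ⟦⟧-cong (i ≟ a) (a ≟ i) sym sym

module _ {n : ℕ} where

  ∑-*ˡ : ∀ x (f : Fin n → ℤ) → sum (λ i → x * f i) ≡ x * sum f
  ∑-*ˡ x f = sym (*-distribˡ-sum x f)

  ∑-*ʳ : ∀ x (f : Fin n → ℤ) → sum (λ i → f i * x) ≡ sum f * x
  ∑-*ʳ x f = sym (*-distribʳ-sum x f)

  ∑-neg : (f : Fin n → ℤ) → sum (λ i → - f i) ≡ - sum f
  ∑-neg f = begin
    sum (λ i → - f i)      ≡⟨ sum-cong-≗ (λ i → sym (ℤ.-1*i≡-i (f i))) ⟩
    sum (λ i → -1ℤ * f i)  ≡⟨ ∑-*ˡ -1ℤ f ⟩
    -1ℤ * sum f            ≡⟨ ℤ.-1*i≡-i (sum f) ⟩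
    - sum f                ∎
    where open ≡-Reasoning

  ∑-distrib-- : (f g : Fin n → ℤ) → sum (λ i → f i - g i) ≡ sum f - sum g
  ∑-distrib-- f g = trans (∑-distrib-+ f (λ i → - g i)) (cong (λ s → sum f + s) (∑-neg g))

  ∑-distrib-+-- : (f g h k : Fin n → ℤ) → sum (λ i → f i + g i - h i - k i) ≡ sum f + sum g - sum h - sum k
  ∑-distrib-+-- f g h k = begin
    sum (λ i → f i + g i - h i - k i)            ≡⟨ ∑-distrib-- (λ i → f i + g i - h i) k ⟩
    sum (λ i → f i + g i - h i) - sum k          ≡⟨ cong (_- sum k) (∑-distrib-- (λ i → f i + g i) h) ⟩
    sum (λ i → f i + g i) - sum h - sum k        ≡⟨ cong (λ x → x - sum h - sum k) (∑-distrib-+ f g) ⟩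
    sum f + sum g - sum h - sum k                ∎
    where open ≡-Reasoning

∑-const : ∀ n x → sum {n} (λ _ → x) ≡ + n * x
∑-const zero x = refl
∑-const (suc n) x = begin
  x + sum {n} (λ _ → x)  ≡⟨ cong (λ s → x + s) (∑-const n x) ⟩
  x + + n * x            ≡⟨ cong (λ s → s + + n * x) (sym (ℤ.*-identityˡ x)) ⟩
  1ℤ * x + + n * x       ≡⟨ sym (ℤ.*-distribʳ-+ x 1ℤ (+ n)) ⟩
  + suc n * x            ∎
  where open ≡-Reasoning

∑-1 : ∀ n → sum {n} (λ _ → 1ℤ) ≡ + n
∑-1 n = trans (∑-const n 1ℤ) (ℤ.*-identityʳ (+ n))

∑-δ : ∀ {n} (a : Fin n) (f : Fin n → ℤ) → sum (λ i → δ a i * f i) ≡ f a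
∑-δ {suc n} zero f = begin
  1ℤ * f zero + sum {n} (λ _ → 0ℤ)  ≡⟨ cong₂ _+_ (ℤ.*-identityˡ (f zero)) (sum-replicate-zero n) ⟩
  f zero + 0ℤ                       ≡⟨ ℤ.+-identityʳ (f zero) ⟩
  f zero                            ∎
  where open ≡-Reasoning
∑-δ {suc n} (suc a) f = trans (ℤ.+-identityˡ _) (∑-δ a (f ∘ suc))

∑-δ-const : ∀ {n} (a : Fin n) → sum (δ a) ≡ 1ℤ
∑-δ-const a = trans (sum-cong-≗ (λ i → sym (ℤ.*-identityʳ (δ a i)))) (∑-δ a (λ _ → 1ℤ))

∑-*δ : ∀ {n} (f : Fin n → ℤ) i → sum (λ a → f a * δ a i) ≡ f i
∑-*δ f i = trans (sum-cong-≗ (λ a → trans (ℤ.*-comm (f a) (δ a i)) (cong (_* f a) (δ-sym a i)))) (∑-δ i f)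

∑-⟦⟧-unique : ∀ {n ℓ₁ ℓ₂} {P : Fin n → Set ℓ₁} {Q : Set ℓ₂} (P? : ∀ d → Dec (P d)) (Q? : Dec Q) d₀ →
  (∀ {d} → P d → d ≡ d₀ × Q) → (Q → P d₀) → sum (λ d → ⟦ P? d ⟧) ≡ ⟦ Q? ⟧
∑-⟦⟧-unique P? Q? d₀ P⇒ ⇒P = trans (sum-cong-≗ pointwise) (∑-δ d₀ (λ _ → ⟦ Q? ⟧))
  where
  pointwise : ∀ d → ⟦ P? d ⟧ ≡ δ d₀ d * ⟦ Q? ⟧
  pointwise d = trans (⟦⟧-cong (P? d) (d ≟ d₀ ×-dec Q?) P⇒ (λ { (refl , q) → ⇒P q })) (sym (⟦×⟧ (d ≟ d₀) Q?))

module _ {n ℓ₁ ℓ₂} {P : Fin n → Set ℓ₁} {Q : Fin n → Set ℓ₂}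
  (P? : ∀ i → Dec (P i)) (Q? : ∀ i → Dec (Q i)) where

  ∑-none-of-2 : (∀ {i} → P i → ¬ Q i) →
    sum (λ i → ⟦ ¬? (P? i) ×-dec ¬? (Q? i) ⟧) ≡ + n - sum (λ i → ⟦ P? i ⟧) - sum (λ i → ⟦ Q? i ⟧)
  ∑-none-of-2 P∩Q=∅ = begin
    sum (λ i → ⟦ ¬? (P? i) ×-dec ¬? (Q? i) ⟧)  ≡⟨ sum-cong-≗ (λ i → ⟦none-of-2⟧ (P? i) (Q? i) P∩Q=∅) ⟩
    sum (λ i → 1ℤ - ⟦ P? i ⟧ - ⟦ Q? i ⟧)        ≡⟨ ∑-distrib-- (λ i → 1ℤ - ⟦ P? i ⟧) (λ i → ⟦ Q? i ⟧) ⟩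
    sum (λ i → 1ℤ - ⟦ P? i ⟧) - #Q              ≡⟨ cong (_- #Q) (∑-distrib-- (λ _ → 1ℤ) (λ i → ⟦ P? i ⟧)) ⟩
    sum {n} (λ _ → 1ℤ) - #P - #Q                ≡⟨ cong (λ x → x - #P - #Q) (∑-1 n) ⟩
    + n - #P - #Q                               ∎
    where
    open ≡-Reasoning
    #P #Q : ℤ
    #P = sum (λ i → ⟦ P? i ⟧)
    #Q = sum (λ i → ⟦ Q? i ⟧)

module _ {n ℓ₁ ℓ₂ ℓ₃} {P : Fin n → Set ℓ₁} {Q : Fin n → Set ℓ₂} {R : Fin n → Set ℓ₃}
  (P? : ∀ i → Dec (P i)) (Q? : ∀ i → Dec (Q i)) (R? : ∀ i → Dec (R i)) where

  ∑-none-of-3 : (∀ {i} → P i → ¬ Q i) → (∀ {i} → P i → ¬ R i) → (∀ {i} → Q i → ¬ R i) →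
    sum (λ i → ⟦ ¬? (P? i) ×-dec ¬? (Q? i) ×-dec ¬? (R? i) ⟧)
      ≡ + n - sum (λ i → ⟦ P? i ⟧) - sum (λ i → ⟦ Q? i ⟧) - sum (λ i → ⟦ R? i ⟧)
  ∑-none-of-3 P∩Q=∅ P∩R=∅ Q∩R=∅ = begin
    sum (λ i → ⟦ ¬? (P? i) ×-dec ¬? (Q? i) ×-dec ¬? (R? i) ⟧)
      ≡⟨ sum-cong-≗ (λ i → ⟦none-of-3⟧ (P? i) (Q? i) (R? i) P∩Q=∅ P∩R=∅ Q∩R=∅) ⟩
    sum (λ i → 1ℤ - ⟦ P? i ⟧ - ⟦ Q? i ⟧ - ⟦ R? i ⟧)
      ≡⟨ ∑-distrib-- (λ i → 1ℤ - ⟦ P? i ⟧ - ⟦ Q? i ⟧) (λ i → ⟦ R? i ⟧) ⟩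
    sum (λ i → 1ℤ - ⟦ P? i ⟧ - ⟦ Q? i ⟧) - #R
      ≡⟨ cong (_- #R) (∑-distrib-- (λ i → 1ℤ - ⟦ P? i ⟧) (λ i → ⟦ Q? i ⟧)) ⟩
    sum (λ i → 1ℤ - ⟦ P? i ⟧) - #Q - #R
      ≡⟨ cong (λ x → x - #Q - #R) (∑-distrib-- (λ _ → 1ℤ) (λ i → ⟦ P? i ⟧)) ⟩
    sum {n} (λ _ → 1ℤ) - #P - #Q - #R
      ≡⟨ cong (λ x → x - #P - #Q - #R) (∑-1 n) ⟩
    + n - #P - #Q - #R
      ∎
    where
    open ≡-Reasoning
    #P #Q #R : ℤ
    #P = sum (λ i → ⟦ P? i ⟧)
    #Q = sum (λ i → ⟦ Q? i ⟧)
    #R = sum (λ i → ⟦ R? i ⟧)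

zeroAt : ∀ {n} → Fin n → (Fin n → ℤ) → Fin n → ℤ
zeroAt a f i = if does (i ≟ a) then 0ℤ else f i

module _ {n : ℕ} (a : Fin n) (f : Fin n → ℤ) where

  zeroAt-at : zeroAt a f a ≡ 0ℤ
  zeroAt-at with a ≟ a
  ... | yes _ = refl
  ... | no a≢a = ⊥-elim (a≢a refl)

  zeroAt-off : ∀ {i} → i ≢ a → zeroAt a f i ≡ f i
  zeroAt-off {i} i≢a with i ≟ a
  ... | yes i≡a = ⊥-elim (i≢a i≡a)
  ... | no _ = refl

  zeroAt-nonneg : (∀ i → 0ℤ ≤ f i) → ∀ i → 0ℤ ≤ zeroAt a f i
  zeroAt-nonneg f≥0 i with does (i ≟ a)
  ... | true = ℤ.≤-refl
  ... | false = f≥0 i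

∑-zeroAt : ∀ {n} (a : Fin n) (f : Fin n → ℤ) → sum f ≡ f a + sum (zeroAt a f)
∑-zeroAt {suc n} zero f = cong (λ s → f zero + s) (sym (ℤ.+-identityˡ _))
∑-zeroAt {suc n} (suc a) f = begin
  f zero + sum (f ∘ suc)                                  ≡⟨ cong (λ s → f zero + s) (∑-zeroAt a (f ∘ suc)) ⟩
  f zero + (f (suc a) + sum (zeroAt a (f ∘ suc)))         ≡⟨ x∙yz≈y∙xz (f zero) (f (suc a)) _ ⟩
  f (suc a) + (f zero + sum (zeroAt a (f ∘ suc)))         ∎
  where open ≡-Reasoning

∑-nonneg : ∀ {n} (f : Fin n → ℤ) → (∀ i → 0ℤ ≤ f i) → 0ℤ ≤ sum f
∑-nonneg {zero} f f≥0 = ℤ.≤-refl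
∑-nonneg {suc n} f f≥0 = ℤ.+-mono-≤ (f≥0 zero) (∑-nonneg (f ∘ suc) (f≥0 ∘ suc))

∑-nonneg-≥ : ∀ {n} (f : Fin n → ℤ) → (∀ i → 0ℤ ≤ f i) → ∀ a → f a ≤ sum f
∑-nonneg-≥ f f≥0 a = begin
  f a                        ≡⟨ ℤ.+-identityʳ (f a) ⟨
  f a + 0ℤ                   ≤⟨ ℤ.+-monoʳ-≤ (f a) (∑-nonneg (zeroAt a f) (zeroAt-nonneg a f f≥0)) ⟩
  f a + sum (zeroAt a f)     ≡⟨ ∑-zeroAt a f ⟨
  sum f                      ∎
  where open ℤ.≤-Reasoning

∑-nonneg≡0⇒≡0 : ∀ {n} (f : Fin n → ℤ) → (∀ i → 0ℤ ≤ f i) → sum f ≡ 0ℤ → ∀ a → f a ≡ 0ℤ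
∑-nonneg≡0⇒≡0 f f≥0 ∑f≡0 a = ℤ.≤-antisym (subst (f a ≤_) ∑f≡0 (∑-nonneg-≥ f f≥0 a)) (f≥0 a)

∑≡0⇒∃pos : ∀ {n} (f : Fin n → ℤ) → sum f ≡ 0ℤ → ∀ {i} → f i ≢ 0ℤ → ∃ λ p → 0ℤ < f p
∑≡0⇒∃pos f ∑f≡0 {i} fi≢0 with any? (λ p → 0ℤ ℤ.<? f p)
... | yes pos = pos
... | no ¬pos = ⊥-elim (fi≢0 (trans (sym (ℤ.neg-involutive (f i))) (cong -_ -fi≡0)))
  where
  -f≥0 : ∀ p → 0ℤ ≤ - f p
  -f≥0 p = ℤ.neg-mono-≤ (ℤ.≮⇒≥ (λ 0<fp → ¬pos (p , 0<fp)))
  -fi≡0 : - f i ≡ 0ℤ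
  -fi≡0 = ∑-nonneg≡0⇒≡0 (λ p → - f p) -f≥0 (trans (∑-neg f) (cong -_ ∑f≡0)) i

∑≡0⇒∃neg : ∀ {n} (f : Fin n → ℤ) → sum f ≡ 0ℤ → ∀ {i} → f i ≢ 0ℤ → ∃ λ q → f q < 0ℤ
∑≡0⇒∃neg f ∑f≡0 fi≢0
  with ∑≡0⇒∃pos (λ p → - f p) (trans (∑-neg f) (cong -_ ∑f≡0)) (fi≢0 ∘ ℤ.neg-injective)
... | q , 0<-fq = q , ℤ.neg-cancel-< 0<-fq

-- Integer arithmetic

+-cancelˡ-≤ : ∀ k {x y} → k + x ≤ k + y → x ≤ y
+-cancelˡ-≤ k {x} {y} k+x≤k+y = subst₂ _≤_ (cancel x) (cancel y) (ℤ.+-monoʳ-≤ (- k) k+x≤k+y)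
  where
  cancel : ∀ z → - k + (k + z) ≡ z
  cancel z = solve 2 (λ k z → :- k :+ (k :+ z) := z) refl k z

x+pos≤z⇒x<z : ∀ {x y z} → 0ℤ < y → x + y ≤ z → x < z
x+pos≤z⇒x<z {x} {y} {z} 0<y x+y≤z = begin-strict
  x        ≡⟨ sym (ℤ.+-identityʳ x) ⟩
  x + 0ℤ   <⟨ ℤ.+-monoʳ-< x 0<y ⟩
  x + y    ≤⟨ x+y≤z ⟩
  z        ∎
  where open ℤ.≤-Reasoning

2*z≢1 : ∀ z → + 2 * z ≢ 1ℤ
2*z≢1 (+ zero) ()
2*z≢1 (+ suc k) 2+2k≡1 = ℕ.m+1+n≢0 k (cong ℕ.pred (ℤ.+-injective 2+2k≡1))
2*z≢1 -[1+ _ ] ()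

square-nonneg : ∀ x → 0ℤ ≤ x * x
square-nonneg (+ zero) = +≤+ z≤n
square-nonneg (+ suc _) = +≤+ z≤n
square-nonneg -[1+ _ ] = +≤+ z≤n

square-pos : ∀ {x} → x ≢ 0ℤ → 0ℤ < x * x
square-pos {+ zero} x≢0 = ⊥-elim (x≢0 refl)
square-pos {+ suc _} _ = +<+ (s≤s z≤n)
square-pos { -[1+ _ ]} _ = +<+ (s≤s z≤n)

private
  4≤[2+k]² : ∀ k → 4 ℕ.≤ suc (suc k) ℕ.* suc (suc k)
  4≤[2+k]² k = ℕ.*-mono-≤ {2} {suc (suc k)} (s≤s (s≤s z≤n)) (s≤s (s≤s z≤n))

pos-square<4⇒≡1 : ∀ {x} → 0ℤ < x → x * x < + 4 → x ≡ 1ℤ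
pos-square<4⇒≡1 {+ zero} (+<+ ()) _
pos-square<4⇒≡1 {+ suc zero} _ _ = refl
pos-square<4⇒≡1 {+ suc (suc k)} _ (+<+ x²<4) = ⊥-elim (ℕ.<-irrefl refl (ℕ.<-≤-trans x²<4 (4≤[2+k]² k)))

neg-square<4⇒≡-1 : ∀ {x} → x < 0ℤ → x * x < + 4 → x ≡ -1ℤ
neg-square<4⇒≡-1 {+ _} (+<+ ()) _
neg-square<4⇒≡-1 { -[1+ zero ]} _ _ = refl
neg-square<4⇒≡-1 { -[1+ suc k ]} _ (+<+ x²<4) = ⊥-elim (ℕ.<-irrefl refl (ℕ.<-≤-trans x²<4 (4≤[2+k]² k)))

-- Integer vectors of squared norm at most 4

‖_‖² : ∀ {n} → (Fin n → ℤ) → ℤ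
‖ f ‖² = sum (λ i → f i * f i)

‖‖²-nonneg : ∀ {n} (f : Fin n → ℤ) → 0ℤ ≤ ‖ f ‖²
‖‖²-nonneg f = ∑-nonneg _ (λ i → square-nonneg (f i))

‖‖²≤0⇒≡0 : ∀ {n} (f : Fin n → ℤ) → ‖ f ‖² ≤ 0ℤ → ∀ i → f i ≡ 0ℤ
‖‖²≤0⇒≡0 f ‖f‖²≤0 i with f i ℤ.≟ 0ℤ
... | yes fi≡0 = fi≡0
... | no fi≢0 = ⊥-elim (ℤ.<-irrefl (sym fi²≡0) (square-pos fi≢0))
  where
  fi²≡0 : f i * f i ≡ 0ℤ
  fi²≡0 = ∑-nonneg≡0⇒≡0 _ (λ j → square-nonneg (f j)) (ℤ.≤-antisym ‖f‖²≤0 (‖‖²-nonneg f)) i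

zeroAt₂ : ∀ {n} → Fin n → Fin n → (Fin n → ℤ) → Fin n → ℤ
zeroAt₂ p q f = zeroAt q (zeroAt p f)

module _ {n : ℕ} {p q : Fin n} (p≢q : p ≢ q) (f : Fin n → ℤ) where

  zeroAt₂-at-p : zeroAt₂ p q f p ≡ 0ℤ
  zeroAt₂-at-p = trans (zeroAt-off q (zeroAt p f) p≢q) (zeroAt-at p f)

  zeroAt₂-at-q : zeroAt₂ p q f q ≡ 0ℤ
  zeroAt₂-at-q = zeroAt-at q (zeroAt p f)

  zeroAt₂-support : ∀ {x} → zeroAt₂ p q f x ≢ 0ℤ → x ≢ p × x ≢ q
  zeroAt₂-support fx≢0 = (λ { refl → fx≢0 zeroAt₂-at-p }) , (λ { refl → fx≢0 zeroAt₂-at-q })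

  zeroAt₂-square : ∀ i → zeroAt₂ p q f i * zeroAt₂ p q f i ≡ zeroAt₂ p q (λ j → f j * f j) i
  zeroAt₂-square i with does (i ≟ q) | does (i ≟ p)
  ... | true | _ = refl
  ... | false | true = refl
  ... | false | false = refl

  ∑-zeroAt₂ : ∀ (g : Fin n → ℤ) → sum g ≡ g p + (g q + sum (zeroAt₂ p q g))
  ∑-zeroAt₂ g = trans (∑-zeroAt p g) (cong (λ s → g p + s)
    (trans (∑-zeroAt q (zeroAt p g)) (cong (λ s → s + sum (zeroAt₂ p q g)) (zeroAt-off p g (p≢q ∘ sym)))))

  ‖‖²-zeroAt₂ : ‖ f ‖² ≡ f p * f p + (f q * f q + ‖ zeroAt₂ p q f ‖²)
  ‖‖²-zeroAt₂ = trans (∑-zeroAt₂ (λ j → f j * f j))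
    (cong (λ s → f p * f p + (f q * f q + s)) (sym (sum-cong-≗ zeroAt₂-square)))

  zeroAt₂-decompose : ∀ i → f i ≡ δ p i * f p + δ q i * f q + zeroAt₂ p q f i
  zeroAt₂-decompose i with i ≟ p | i ≟ q
  ... | yes refl | yes i≡q = ⊥-elim (p≢q i≡q)
  ... | yes refl | no _ =
    solve 2 (λ x y → x := con 1ℤ :* x :+ con 0ℤ :* y :+ con 0ℤ) refl (f p) (f q)
  ... | no _ | yes refl =
    solve 2 (λ x y → y := con 0ℤ :* x :+ con 1ℤ :* y :+ con 0ℤ) refl (f p) (f q)
  ... | no _ | no _ =
    sym (ℤ.+-identityˡ (f i))

record Peeled {n} (f : Fin n → ℤ) : Set where
  field
    p q : Fin n
    p≢q : p ≢ q
    fp≡1 : f p ≡ 1ℤ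
    fq≡-1 : f q ≡ -1ℤ
    ∑-rest : sum (zeroAt₂ p q f) ≡ 0ℤ
    ‖rest‖² : ‖ f ‖² ≡ + 2 + ‖ zeroAt₂ p q f ‖²

  decompose : ∀ i → f i ≡ δ p i - δ q i + zeroAt₂ p q f i
  decompose i = trans (zeroAt₂-decompose p≢q f i)
    (trans (cong₂ (λ x y → δ p i * x + δ q i * y + zeroAt₂ p q f i) fp≡1 fq≡-1)
           (solve 3 (λ u v w → u :* con 1ℤ :+ v :* con -1ℤ :+ w := u :- v :+ w) refl (δ p i) (δ q i) (zeroAt₂ p q f i)))

peel : ∀ {n} (f : Fin n → ℤ) → sum f ≡ 0ℤ → ‖ f ‖² ≤ + 4 → ∀ {i} → f i ≢ 0ℤ → Peeled f
peel f ∑f≡0 ‖f‖²≤4 fi≢0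
  with ∑≡0⇒∃pos f ∑f≡0 fi≢0 | ∑≡0⇒∃neg f ∑f≡0 fi≢0
... | p , 0<fp | q , fq<0 = record
  { p = p ; q = q ; p≢q = p≢q ; fp≡1 = fp≡1 ; fq≡-1 = fq≡-1 ; ∑-rest = ∑-rest ; ‖rest‖² = ‖rest‖² }
  where
  p≢q : p ≢ q
  p≢q refl = ℤ.<-asym 0<fp fq<0
  0<fq²+rest : 0ℤ < f q * f q + ‖ zeroAt₂ p q f ‖²
  0<fq²+rest = ℤ.+-mono-<-≤ (square-pos (λ fq≡0 → ℤ.<-irrefl fq≡0 fq<0)) (‖‖²-nonneg (zeroAt₂ p q f))
  0<fp²+rest : 0ℤ < f p * f p + ‖ zeroAt₂ p q f ‖²
  0<fp²+rest = ℤ.+-mono-<-≤ (square-pos (λ fp≡0 → ℤ.<-irrefl (sym fp≡0) 0<fp)) (‖‖²-nonneg (zeroAt₂ p q f))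
  split : ‖ f ‖² ≡ f p * f p + (f q * f q + ‖ zeroAt₂ p q f ‖²)
  split = ‖‖²-zeroAt₂ p≢q f
  fp≡1 : f p ≡ 1ℤ
  fp≡1 = pos-square<4⇒≡1 0<fp (x+pos≤z⇒x<z 0<fq²+rest (subst (_≤ + 4) split ‖f‖²≤4))
  fq≡-1 : f q ≡ -1ℤ
  fq≡-1 = neg-square<4⇒≡-1 fq<0 (x+pos≤z⇒x<z 0<fp²+rest
    (subst (_≤ + 4) (trans split (x∙yz≈y∙xz (f p * f p) (f q * f q) _)) ‖f‖²≤4))
  ∑-rest : sum (zeroAt₂ p q f) ≡ 0ℤ
  ∑-rest = begin
    sum (zeroAt₂ p q f)                     ≡⟨ solve 1 (λ x → x := con 1ℤ :+ (con -1ℤ :+ x)) refl _ ⟩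
    1ℤ + (-1ℤ + sum (zeroAt₂ p q f))        ≡⟨ cong₂ (λ x y → x + (y + sum (zeroAt₂ p q f))) fp≡1 fq≡-1 ⟨
    f p + (f q + sum (zeroAt₂ p q f))       ≡⟨ ∑-zeroAt₂ p≢q f f ⟨
    sum f                                   ≡⟨ ∑f≡0 ⟩
    0ℤ                                      ∎
    where open ≡-Reasoning
  ‖rest‖² : ‖ f ‖² ≡ + 2 + ‖ zeroAt₂ p q f ‖²
  ‖rest‖² = begin
    ‖ f ‖²                                               ≡⟨ split ⟩
    f p * f p + (f q * f q + ‖ zeroAt₂ p q f ‖²)
      ≡⟨ cong₂ (λ x y → x * x + (y * y + ‖ zeroAt₂ p q f ‖²)) fp≡1 fq≡-1 ⟩
    1ℤ + (1ℤ + ‖ zeroAt₂ p q f ‖²)                       ≡⟨ ℤ.+-assoc 1ℤ 1ℤ (‖ zeroAt₂ p q f ‖²) ⟨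
    + 2 + ‖ zeroAt₂ p q f ‖²                             ∎
    where open ≡-Reasoning

record Distinct4 {n} (a b c d : Fin n) : Set where
  constructor distinct4
  field
    a≢b : a ≢ b
    a≢c : a ≢ c
    a≢d : a ≢ d
    b≢c : b ≢ c
    b≢d : b ≢ d
    c≢d : c ≢ d

distinct4? : ∀ {n} (a b c d : Fin n) → Dec (Distinct4 a b c d)
distinct4? a b c d = map′
  (λ (a≢b , a≢c , a≢d , b≢c , b≢d , c≢d) → distinct4 a≢b a≢c a≢d b≢c b≢d c≢d)
  (λ (distinct4 a≢b a≢c a≢d b≢c b≢d c≢d) → a≢b , a≢c , a≢d , b≢c , b≢d , c≢d)
  (¬? (a ≟ b) ×-dec ¬? (a ≟ c) ×-dec ¬? (a ≟ d) ×-dec ¬? (b ≟ c) ×-dec ¬? (b ≟ d) ×-dec ¬? (c ≟ d))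

module _ {n} {a b c d : Fin n} (D : Distinct4 a b c d) where
  open Distinct4 D

  distinct4-swapᵃᵇ : Distinct4 b a c d
  distinct4-swapᵃᵇ = distinct4 (a≢b ∘ sym) b≢c b≢d a≢c a≢d c≢d

  distinct4-swapᶜᵈ : Distinct4 a b d c
  distinct4-swapᶜᵈ = distinct4 a≢b a≢d a≢c b≢d b≢c (c≢d ∘ sym)

  distinct4-swap-pairs : Distinct4 c d a b
  distinct4-swap-pairs = distinct4 c≢d (a≢c ∘ sym) (b≢c ∘ sym) (a≢d ∘ sym) (b≢d ∘ sym) a≢b

quad : ∀ {n} → Fin n → Fin n → Fin n → Fin n → Fin n → ℤ
quad a b c d i = δ a i + δ b i - δ c i - δ d i

quadVec : ∀ {n} → Fin n → Fin n → Fin n → Fin n → Vec ℤ n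
quadVec a b c d = tabulate (quad a b c d)

_≟ᵥ_ : ∀ {n} (x y : Vec ℤ n) → Dec (x ≡ y)
_≟ᵥ_ = ≡-decᵥ ℤ._≟_

module _ {n : ℕ} (a b c d : Fin n) where

  quad-swapᵃᵇ : ∀ i → quad b a c d i ≡ quad a b c d i
  quad-swapᵃᵇ i = solve 4 (λ x y z w → y :+ x :- z :- w := x :+ y :- z :- w) refl (δ a i) (δ b i) (δ c i) (δ d i)

  quad-swapᶜᵈ : ∀ i → quad a b d c i ≡ quad a b c d i
  quad-swapᶜᵈ i = solve 4 (λ x y z w → x :+ y :- w :- z := x :+ y :- z :- w) refl (δ a i) (δ b i) (δ c i) (δ d i)

  quad-swap-pairs : ∀ i → quad c d a b i ≡ - quad a b c d i
  quad-swap-pairs i = solve 4 (λ x y z w → z :+ w :- x :- y := :- (x :+ y :- z :- w)) refl (δ a i) (δ b i) (δ c i) (δ d i)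

  ∑-quad-weighted : ∀ (f : Fin n → ℤ) → sum (λ i → quad a b c d i * f i) ≡ f a + f b - f c - f d
  ∑-quad-weighted f = begin
    sum (λ i → quad a b c d i * f i)
      ≡⟨ sum-cong-≗ (λ i → solve 5 (λ x y z w u → (x :+ y :- z :- w) :* u := x :* u :+ y :* u :- z :* u :- w :* u)
                                   refl (δ a i) (δ b i) (δ c i) (δ d i) (f i)) ⟩
    sum (λ i → δ a i * f i + δ b i * f i - δ c i * f i - δ d i * f i)
      ≡⟨ ∑-distrib-+-- (λ i → δ a i * f i) (λ i → δ b i * f i) (λ i → δ c i * f i) (λ i → δ d i * f i) ⟩
    sum (λ i → δ a i * f i) + sum (λ i → δ b i * f i) - sum (λ i → δ c i * f i) - sum (λ i → δ d i * f i)
      ≡⟨ cong₂ (λ x y → x - y - sum (λ i → δ d i * f i)) (cong₂ _+_ (∑-δ a f) (∑-δ b f)) (∑-δ c f) ⟩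
    f a + f b - f c - sum (λ i → δ d i * f i)
      ≡⟨ cong (λ x → f a + f b - f c - x) (∑-δ d f) ⟩
    f a + f b - f c - f d
      ∎
    where open ≡-Reasoning

  ∑-quad : sum (quad a b c d) ≡ 0ℤ
  ∑-quad = trans (sum-cong-≗ (λ i → sym (ℤ.*-identityʳ (quad a b c d i)))) (∑-quad-weighted (λ _ → 1ℤ))

  quad≡1⇒ : ∀ {i} → quad a b c d i ≡ 1ℤ → i ≡ a ⊎ i ≡ b
  quad≡1⇒ {i} q≡1 with i ≟ a | i ≟ b | i ≟ c | i ≟ d
  ... | yes i≡a | _ | _ | _ = inj₁ i≡a
  ... | no _ | yes i≡b | _ | _ = inj₂ i≡b
  quad≡1⇒ () | no _ | no _ | yes _ | yes _
  quad≡1⇒ () | no _ | no _ | yes _ | no _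
  quad≡1⇒ () | no _ | no _ | no _ | yes _
  quad≡1⇒ () | no _ | no _ | no _ | no _

  quad≡-1⇒ : ∀ {i} → quad a b c d i ≡ -1ℤ → i ≡ c ⊎ i ≡ d
  quad≡-1⇒ {i} q≡-1 with i ≟ c | i ≟ d | i ≟ a | i ≟ b
  ... | yes i≡c | _ | _ | _ = inj₁ i≡c
  ... | no _ | yes i≡d | _ | _ = inj₂ i≡d
  quad≡-1⇒ () | no _ | no _ | yes _ | yes _
  quad≡-1⇒ () | no _ | no _ | yes _ | no _
  quad≡-1⇒ () | no _ | no _ | no _ | yes _
  quad≡-1⇒ () | no _ | no _ | no _ | no _

module _ {n : ℕ} {a b c d : Fin n} (D : Distinct4 a b c d) where
  open Distinct4 D

  quad-at-a : quad a b c d a ≡ 1ℤ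
  quad-at-a rewrite δ-diag a | δ-off {a = b} a≢b | δ-off {a = c} a≢c | δ-off {a = d} a≢d = refl

  quad-at-b : quad a b c d b ≡ 1ℤ
  quad-at-b rewrite δ-off {a = a} (a≢b ∘ sym) | δ-diag b | δ-off {a = c} b≢c | δ-off {a = d} b≢d = refl

  quad-at-c : quad a b c d c ≡ -1ℤ
  quad-at-c rewrite δ-off {a = a} (a≢c ∘ sym) | δ-off {a = b} (b≢c ∘ sym) | δ-diag c | δ-off {a = d} c≢d = refl

  quad-at-d : quad a b c d d ≡ -1ℤ
  quad-at-d rewrite δ-off {a = a} (a≢d ∘ sym) | δ-off {a = b} (b≢d ∘ sym) | δ-off {a = c} (c≢d ∘ sym) | δ-diag d = refl

  ‖quad‖² : ‖ quad a b c d ‖² ≡ + 4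
  ‖quad‖² = begin
    ‖ quad a b c d ‖²        ≡⟨ ∑-quad-weighted a b c d q ⟩
    q a + q b - q c - q d    ≡⟨ cong₂ (λ x y → x + y - q c - q d) quad-at-a quad-at-b ⟩
    1ℤ + 1ℤ - q c - q d      ≡⟨ cong₂ (λ x y → 1ℤ + 1ℤ - x - y) quad-at-c quad-at-d ⟩
    + 4                      ∎
    where
    open ≡-Reasoning
    q : Fin n → ℤ
    q = quad a b c d

data SmallShape {n} (f : Fin n → ℤ) : Set where
  difference : ∀ {a c} → a ≢ c → (∀ i → f i ≡ δ a i - δ c i) → SmallShape f
  quadruple : ∀ {a b c d} → Distinct4 a b c d → (∀ i → f i ≡ quad a b c d i) → SmallShape f

small-shape : ∀ {n} (f : Fin n → ℤ) → sum f ≡ 0ℤ → ‖ f ‖² ≤ + 4 → ∀ {i} → f i ≢ 0ℤ → SmallShape f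
small-shape {n} f ∑f≡0 ‖f‖²≤4 fi≢0 = go (all? (λ i → r i ℤ.≟ 0ℤ))
  where
  open Peeled (peel f ∑f≡0 ‖f‖²≤4 fi≢0) using (∑-rest; ‖rest‖²; decompose) renaming (p to a; q to c; p≢q to a≢c)
  r : Fin n → ℤ
  r = zeroAt₂ a c f
  ‖r‖²≤2 : ‖ r ‖² ≤ + 2
  ‖r‖²≤2 = +-cancelˡ-≤ (+ 2) (subst (_≤ + 4) ‖rest‖² ‖f‖²≤4)
  go : Dec (∀ i → r i ≡ 0ℤ) → SmallShape f
  go (yes r≡0) = difference a≢c λ i →
    trans (decompose i) (trans (cong (λ x → δ a i - δ c i + x) (r≡0 i)) (ℤ.+-identityʳ _))
  go (no r≢0) with ¬∀⟶∃¬ n _ (λ i → r i ℤ.≟ 0ℤ) r≢0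
  ... | j , rj≢0 = quadruple (distinct4 a≢b a≢c a≢d b≢c b≢d c≢d) f≗quad
    where
    open Peeled (peel r ∑-rest (ℤ.≤-trans ‖r‖²≤2 (+≤+ (s≤s (s≤s z≤n)))) {j} rj≢0) using () renaming
      (p to b; q to d; p≢q to b≢d; fp≡1 to rb≡1; fq≡-1 to rd≡-1; ‖rest‖² to ‖r‖²-split; decompose to decompose-r)
    s≡0 : ∀ i → zeroAt₂ b d r i ≡ 0ℤ
    s≡0 = ‖‖²≤0⇒≡0 _ (+-cancelˡ-≤ (+ 2) {y = 0ℤ} (subst (_≤ + 2) ‖r‖²-split ‖r‖²≤2))
    b≢a×b≢c : b ≢ a × b ≢ c
    b≢a×b≢c = zeroAt₂-support a≢c f (λ rb≡0 → case trans (sym rb≡1) rb≡0 of λ ())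
    d≢a×d≢c : d ≢ a × d ≢ c
    d≢a×d≢c = zeroAt₂-support a≢c f (λ rd≡0 → case trans (sym rd≡-1) rd≡0 of λ ())
    a≢b : a ≢ b
    a≢b = proj₁ b≢a×b≢c ∘ sym
    b≢c : b ≢ c
    b≢c = proj₂ b≢a×b≢c
    a≢d : a ≢ d
    a≢d = proj₁ d≢a×d≢c ∘ sym
    c≢d : c ≢ d
    c≢d = proj₂ d≢a×d≢c ∘ sym
    f≗quad : ∀ i → f i ≡ quad a b c d i
    f≗quad i = begin
      f i                                          ≡⟨ decompose i ⟩
      δ a i - δ c i + r i                          ≡⟨ cong (λ x → δ a i - δ c i + x) (decompose-r i) ⟩
      δ a i - δ c i + (δ b i - δ d i + zeroAt₂ b d r i)
        ≡⟨ cong (λ x → δ a i - δ c i + (δ b i - δ d i + x)) (s≡0 i) ⟩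
      δ a i - δ c i + (δ b i - δ d i + 0ℤ)
        ≡⟨ solve 4 (λ u v w x → u :- w :+ (v :- x :+ con 0ℤ) := u :+ v :- w :- x) refl (δ a i) (δ b i) (δ c i) (δ d i) ⟩
      quad a b c d i                               ∎
      where open ≡-Reasoning

SamePair : ∀ {n} → Fin n → Fin n → Fin n → Fin n → Set
SamePair p r a b = (a ≡ p × b ≡ r) ⊎ (a ≡ r × b ≡ p)

samePair? : ∀ {n} (p r a b : Fin n) → Dec (SamePair p r a b)
samePair? p r a b = (a ≟ p ×-dec b ≟ r) ⊎-dec (a ≟ r ×-dec b ≟ p)

samePair : ∀ {n} {p r a b : Fin n} → a ≢ b → a ≡ p ⊎ a ≡ r → b ≡ p ⊎ b ≡ r → SamePair p r a b
samePair a≢b (inj₁ a≡p) (inj₁ b≡p) = ⊥-elim (a≢b (trans a≡p (sym b≡p)))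
samePair a≢b (inj₁ a≡p) (inj₂ b≡r) = inj₁ (a≡p , b≡r)
samePair a≢b (inj₂ a≡r) (inj₁ b≡p) = inj₂ (a≡r , b≡p)
samePair a≢b (inj₂ a≡r) (inj₂ b≡r) = ⊥-elim (a≢b (trans a≡r (sym b≡r)))

quadVec≡⇒samePairs : ∀ {n} {a b c d p r q s : Fin n} → Distinct4 a b c d → quadVec a b c d ≡ quadVec p r q s →
                     SamePair p r a b × SamePair q s c d
quadVec≡⇒samePairs {a = a} {b} {c} {d} {p} {r} {q} {s} D quads≡ =
  samePair (Distinct4.a≢b D) (quad≡1⇒ p r q s (at a (quad-at-a D))) (quad≡1⇒ p r q s (at b (quad-at-b D))) ,
  samePair (Distinct4.c≢d D) (quad≡-1⇒ p r q s (at c (quad-at-c D))) (quad≡-1⇒ p r q s (at d (quad-at-d D)))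
  where
  at : ∀ i {v} → quad a b c d i ≡ v → quad p r q s i ≡ v
  at i = trans (trans (sym (lookup∘tabulate (quad p r q s) i))
                      (trans (cong (λ x → lookup x i) (sym quads≡)) (lookup∘tabulate (quad a b c d) i)))

-- Multiple sums

∑² : ∀ {n} → (Fin n → Fin n → ℤ) → ℤ
∑² F = sum λ a → sum λ b → F a b

∑³ : ∀ {n} → (Fin n → Fin n → Fin n → ℤ) → ℤ
∑³ F = sum λ a → ∑² (F a)

∑⁴ : ∀ {n} → (Fin n → Fin n → Fin n → Fin n → ℤ) → ℤ
∑⁴ F = sum λ a → ∑³ (F a)

module _ {n : ℕ} where

  private
    F⁴ : Set
    F⁴ = Fin n → Fin n → Fin n → Fin n → ℤ

  ∑²-cong : ∀ {F G : Fin n → Fin n → ℤ} → (∀ a b → F a b ≡ G a b) → ∑² F ≡ ∑² G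
  ∑²-cong F≗G = sum-cong-≗ λ a → sum-cong-≗ (F≗G a)

  ∑³-cong : ∀ {F G : Fin n → Fin n → Fin n → ℤ} → (∀ a b c → F a b c ≡ G a b c) → ∑³ F ≡ ∑³ G
  ∑³-cong F≗G = sum-cong-≗ λ a → ∑²-cong (F≗G a)

  ∑⁴-cong : ∀ {F G : F⁴} → (∀ a b c d → F a b c d ≡ G a b c d) → ∑⁴ F ≡ ∑⁴ G
  ∑⁴-cong F≗G = sum-cong-≗ λ a → ∑³-cong (F≗G a)

  ∑²-distrib-+ : ∀ (F G : Fin n → Fin n → ℤ) → ∑² (λ a b → F a b + G a b) ≡ ∑² F + ∑² G
  ∑²-distrib-+ F G =
    trans (sum-cong-≗ λ a → ∑-distrib-+ (F a) (G a)) (∑-distrib-+ (λ a → sum (F a)) (λ a → sum (G a)))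

  ∑³-distrib-+ : ∀ (F G : Fin n → Fin n → Fin n → ℤ) → ∑³ (λ a b c → F a b c + G a b c) ≡ ∑³ F + ∑³ G
  ∑³-distrib-+ F G =
    trans (sum-cong-≗ λ a → ∑²-distrib-+ (F a) (G a)) (∑-distrib-+ (λ a → ∑² (F a)) (λ a → ∑² (G a)))

  ∑⁴-distrib-+ : ∀ (F G : F⁴) → ∑⁴ (λ a b c d → F a b c d + G a b c d) ≡ ∑⁴ F + ∑⁴ G
  ∑⁴-distrib-+ F G =
    trans (sum-cong-≗ λ a → ∑³-distrib-+ (F a) (G a)) (∑-distrib-+ (λ a → ∑³ (F a)) (λ a → ∑³ (G a)))

  ∑²-neg : ∀ (F : Fin n → Fin n → ℤ) → ∑² (λ a b → - F a b) ≡ - ∑² F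
  ∑²-neg F = trans (sum-cong-≗ λ a → ∑-neg (F a)) (∑-neg (λ a → sum (F a)))

  ∑³-neg : ∀ (F : Fin n → Fin n → Fin n → ℤ) → ∑³ (λ a b c → - F a b c) ≡ - ∑³ F
  ∑³-neg F = trans (sum-cong-≗ λ a → ∑²-neg (F a)) (∑-neg (λ a → ∑² (F a)))

  ∑⁴-neg : ∀ (F : F⁴) → ∑⁴ (λ a b c d → - F a b c d) ≡ - ∑⁴ F
  ∑⁴-neg F = trans (sum-cong-≗ λ a → ∑³-neg (F a)) (∑-neg (λ a → ∑³ (F a)))

  ∑³-distrib-- : ∀ (F G : Fin n → Fin n → Fin n → ℤ) → ∑³ (λ a b c → F a b c - G a b c) ≡ ∑³ F - ∑³ G
  ∑³-distrib-- F G = trans (∑³-distrib-+ F (λ a b c → - G a b c)) (cong (λ x → ∑³ F + x) (∑³-neg G))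

  ∑⁴-distrib-- : ∀ (F G : F⁴) → ∑⁴ (λ a b c d → F a b c d - G a b c d) ≡ ∑⁴ F - ∑⁴ G
  ∑⁴-distrib-- F G = trans (∑⁴-distrib-+ F (λ a b c d → - G a b c d)) (cong (λ x → ∑⁴ F + x) (∑⁴-neg G))

  ∑²-*ʳ : ∀ (F : Fin n → Fin n → ℤ) x → ∑² (λ a b → F a b * x) ≡ ∑² F * x
  ∑²-*ʳ F x = trans (sum-cong-≗ λ a → ∑-*ʳ x (F a)) (∑-*ʳ x (λ a → sum (F a)))

  ∑³-*ʳ : ∀ (F : Fin n → Fin n → Fin n → ℤ) x → ∑³ (λ a b c → F a b c * x) ≡ ∑³ F * x
  ∑³-*ʳ F x = trans (sum-cong-≗ λ a → ∑²-*ʳ (F a) x) (∑-*ʳ x (λ a → ∑² (F a)))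

  ∑⁴-*ʳ : ∀ (F : F⁴) x → ∑⁴ (λ a b c d → F a b c d * x) ≡ ∑⁴ F * x
  ∑⁴-*ʳ F x = trans (sum-cong-≗ λ a → ∑³-*ʳ (F a) x) (∑-*ʳ x (λ a → ∑³ (F a)))

  module _ {N : ℕ} where

    ∑²-comm-sum : ∀ (G : Fin N → Fin n → Fin n → ℤ) →
                  ∑² (λ a b → sum (λ k → G k a b)) ≡ sum (λ k → ∑² (G k))
    ∑²-comm-sum G = trans (sum-cong-≗ λ a → ∑-comm (λ b k → G k a b)) (∑-comm (λ a k → sum (G k a)))

    ∑³-comm-sum : ∀ (G : Fin N → Fin n → Fin n → Fin n → ℤ) →
                  ∑³ (λ a b c → sum (λ k → G k a b c)) ≡ sum (λ k → ∑³ (G k))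
    ∑³-comm-sum G = trans (sum-cong-≗ λ a → ∑²-comm-sum (λ k → G k a)) (∑-comm (λ a k → ∑² (G k a)))

    ∑⁴-comm-sum : ∀ (G : Fin N → F⁴) →
                  ∑⁴ (λ a b c d → sum (λ k → G k a b c d)) ≡ sum (λ k → ∑⁴ (G k))
    ∑⁴-comm-sum G = trans (sum-cong-≗ λ a → ∑³-comm-sum (λ k → G k a)) (∑-comm (λ a k → ∑³ (G k a)))

  ∑²-separable : ∀ (f g : Fin n → ℤ) → ∑² (λ a b → f a * g b) ≡ sum f * sum g
  ∑²-separable f g = trans (sum-cong-≗ λ a → ∑-*ˡ (f a) g) (∑-*ʳ (sum g) f)

  ∑⁴-separable : ∀ (F G : Fin n → Fin n → ℤ) → ∑⁴ (λ a b c d → F a b * G c d) ≡ ∑² F * ∑² G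
  ∑⁴-separable F G = trans
    (∑²-cong λ a b → trans (sum-cong-≗ λ c → ∑-*ˡ (F a b) (G c)) (∑-*ˡ (F a b) (λ c → sum (G c))))
    (∑²-*ʳ F (∑² G))

  ∑⁴-δᵃ : ∀ (F : F⁴) i → ∑⁴ (λ a b c d → F a b c d * δ a i) ≡ ∑³ (F i)
  ∑⁴-δᵃ F i = trans (sum-cong-≗ λ a → ∑³-*ʳ (F a) (δ a i)) (∑-*δ (λ a → ∑³ (F a)) i)

  ∑³-δᵃ : ∀ (F : Fin n → Fin n → Fin n → ℤ) i → ∑³ (λ a b c → F a b c * δ a i) ≡ ∑² (F i)
  ∑³-δᵃ F i = trans (sum-cong-≗ λ a → ∑²-*ʳ (F a) (δ a i)) (∑-*δ (λ a → ∑² (F a)) i)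

  ∑³-δᵇ : ∀ (F : Fin n → Fin n → Fin n → ℤ) i → ∑³ (λ a b c → F a b c * δ b i) ≡ ∑² (λ a c → F a i c)
  ∑³-δᵇ F i = sum-cong-≗ λ a → trans (sum-cong-≗ λ b → ∑-*ʳ (δ b i) (F a b)) (∑-*δ (λ b → sum (F a b)) i)

  ∑³-δᶜ : ∀ (F : Fin n → Fin n → Fin n → ℤ) i → ∑³ (λ a b c → F a b c * δ c i) ≡ ∑² (λ a b → F a b i)
  ∑³-δᶜ F i = sum-cong-≗ λ a → sum-cong-≗ λ b → ∑-*δ (F a b) i

  ∑⁴-swapᵃᵇ : ∀ (F : F⁴) → ∑⁴ F ≡ ∑⁴ (λ a b c d → F b a c d)
  ∑⁴-swapᵃᵇ F = ∑-comm (λ a b → sum λ c → sum λ d → F a b c d)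

  ∑⁴-swapᶜᵈ : ∀ (F : F⁴) → ∑⁴ F ≡ ∑⁴ (λ a b c d → F a b d c)
  ∑⁴-swapᶜᵈ F = sum-cong-≗ λ a → sum-cong-≗ λ b → ∑-comm (F a b)

  ∑⁴-swap-pairs : ∀ (F : F⁴) → ∑⁴ F ≡ ∑⁴ (λ a b c d → F c d a b)
  ∑⁴-swap-pairs F =
    trans (sum-cong-≗ λ a → ∑-comm (λ b c → sum λ d → F a b c d))
    (trans (∑-comm (λ a c → sum λ b → sum λ d → F a b c d))
    (sum-cong-≗ λ c → trans (sum-cong-≗ λ a → ∑-comm (λ b d → F a b c d))
                             (∑-comm (λ a d → sum λ b → F a b c d))))

  ∑⁴-quad-weight : ∀ (F : F⁴) i →
    (∀ a b c d → F b a c d ≡ F a b c d) → (∀ a b c d → F a b d c ≡ F a b c d) →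
    (∀ a b c d → F c d a b ≡ - F a b c d) →
    ∑⁴ (λ a b c d → F a b c d * quad a b c d i) ≡ + 4 * ∑⁴ (λ a b c d → F a b c d * δ a i)
  ∑⁴-quad-weight F i symᵃᵇ symᶜᵈ antisym = begin
    ∑⁴ (λ a b c d → F a b c d * quad a b c d i)
      ≡⟨ ∑⁴-cong (λ a b c d → solve 5 (λ f x y z w → f :* (x :+ y :- z :- w) := f :* x :+ f :* y :- f :* z :- f :* w)
                                 refl (F a b c d) (δ a i) (δ b i) (δ c i) (δ d i)) ⟩
    ∑⁴ (λ a b c d → Fδ a a b c d + Fδ b a b c d - Fδ c a b c d - Fδ d a b c d)
      ≡⟨ ∑⁴-distrib-- (λ a b c d → Fδ a a b c d + Fδ b a b c d - Fδ c a b c d) (λ a b c d → Fδ d a b c d) ⟩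
    ∑⁴ (λ a b c d → Fδ a a b c d + Fδ b a b c d - Fδ c a b c d) - Xd
      ≡⟨ cong (_- Xd) (∑⁴-distrib-- (λ a b c d → Fδ a a b c d + Fδ b a b c d) (λ a b c d → Fδ c a b c d)) ⟩
    ∑⁴ (λ a b c d → Fδ a a b c d + Fδ b a b c d) - Xc - Xd
      ≡⟨ cong (λ x → x - Xc - Xd) (∑⁴-distrib-+ (λ a b c d → Fδ a a b c d) (λ a b c d → Fδ b a b c d)) ⟩
    X + Xb - Xc - Xd
      ≡⟨ cong₂ (λ x y → X + x - y - Xd) Xb≡X Xc≡-X ⟩
    X + X - - X - Xd
      ≡⟨ cong (λ x → X + X - - X - x) (trans Xd≡Xc Xc≡-X) ⟩
    X + X - - X - - X
      ≡⟨ solve 1 (λ x → x :+ x :- :- x :- :- x := con (+ 4) :* x) refl X ⟩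
    + 4 * X
      ∎
    where
    open ≡-Reasoning
    Fδ : Fin n → Fin n → Fin n → Fin n → Fin n → ℤ
    Fδ x a b c d = F a b c d * δ x i
    X Xb Xc Xd : ℤ
    X = ∑⁴ (λ a b c d → Fδ a a b c d)
    Xb = ∑⁴ (λ a b c d → Fδ b a b c d)
    Xc = ∑⁴ (λ a b c d → Fδ c a b c d)
    Xd = ∑⁴ (λ a b c d → Fδ d a b c d)
    Xb≡X : Xb ≡ X
    Xb≡X = trans (∑⁴-swapᵃᵇ (λ a b c d → Fδ b a b c d)) (∑⁴-cong λ a b c d → cong (_* δ a i) (symᵃᵇ a b c d))
    Xc≡-X : Xc ≡ - X
    Xc≡-X = trans (∑⁴-swap-pairs (λ a b c d → Fδ c a b c d))
      (trans (∑⁴-cong λ a b c d → trans (cong (_* δ a i) (antisym a b c d)) (sym (ℤ.neg-distribˡ-* (F a b c d) (δ a i))))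
             (∑⁴-neg (λ a b c d → Fδ a a b c d)))
    Xd≡Xc : Xd ≡ Xc
    Xd≡Xc = trans (∑⁴-swapᶜᵈ (λ a b c d → Fδ d a b c d)) (∑⁴-cong λ a b c d → cong (_* δ c i) (symᶜᵈ a b c d))

∑²-samePair : ∀ {n} {p r : Fin n} → p ≢ r → ∑² (λ a b → ⟦ samePair? p r a b ⟧) ≡ + 2
∑²-samePair {n} {p} {r} p≢r = begin
  ∑² (λ a b → ⟦ samePair? p r a b ⟧)
    ≡⟨ ∑²-cong (λ a b → trans (sym (⟦⊎⟧ (a ≟ p ×-dec b ≟ r) (a ≟ r ×-dec b ≟ p)
                                         λ (a≡p , _) (a≡r , _) → p≢r (trans (sym a≡p) a≡r)))
                              (sym (cong₂ _+_ (⟦×⟧ (a ≟ p) (b ≟ r)) (⟦×⟧ (a ≟ r) (b ≟ p))))) ⟩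
  ∑² (λ a b → δ p a * δ r b + δ r a * δ p b)
    ≡⟨ ∑²-distrib-+ (λ a b → δ p a * δ r b) (λ a b → δ r a * δ p b) ⟩
  ∑² (λ a b → δ p a * δ r b) + ∑² (λ a b → δ r a * δ p b)
    ≡⟨ cong₂ _+_ (∑²-separable (δ p) (δ r)) (∑²-separable (δ r) (δ p)) ⟩
  sum (δ p) * sum (δ r) + sum (δ r) * sum (δ p)
    ≡⟨ cong₂ (λ x y → x * y + y * x) (∑-δ-const p) (∑-δ-const r) ⟩
  + 2
    ∎
  where open ≡-Reasoning

-- Finite combinatorics

∃-VecBool? : ∀ k {P : Vec Bool k → Set} → (∀ v → Dec (P v)) → Dec (∃ P)
∃-VecBool? zero P? with P? []
... | yes p = yes ([] , p)
... | no ¬p = no λ { ([] , p) → ¬p p }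
∃-VecBool? (suc k) P? with ∃-VecBool? k (P? ∘ (true ∷_)) | ∃-VecBool? k (P? ∘ (false ∷_))
... | yes (v , p) | _ = yes (true ∷ v , p)
... | no _ | yes (v , p) = yes (false ∷ v , p)
... | no ¬t | no ¬f = no λ { (true ∷ v , p) → ¬t (v , p) ; (false ∷ v , p) → ¬f (v , p) }

unitVec : ∀ {k} → Fin k → Vec Bool k
unitVec i = tabulate (λ j → does (j ≟ i))

unitVec-injective : ∀ {k} {i j : Fin k} → unitVec i ≡ unitVec j → i ≡ j
unitVec-injective {i = i} {j} eq = compare (i ≟ i) (i ≟ j)
  (trans (sym (lookup∘tabulate (λ l → does (l ≟ i)) i))
         (trans (cong (λ v → lookup v i) eq) (lookup∘tabulate (λ l → does (l ≟ j)) i)))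
  where
  compare : (i≟i : Dec (i ≡ i)) (i≟j : Dec (i ≡ j)) → does i≟i ≡ does i≟j → i ≡ j
  compare _ (yes i≡j) _ = i≡j
  compare (yes _) (no _) ()
  compare (no i≢i) (no _) _ = ⊥-elim (i≢i refl)

unique-fixed-point⇒odd : ∀ {n} (σ : Fin n → Fin n) → (∀ c → σ (σ c) ≡ c) →
  ∀ {z} → σ z ≡ z → (∀ {c} → σ c ≡ c → c ≡ z) → ¬ 2 ∣ n
unique-fixed-point⇒odd {n} σ σ²≡id {z} σz≡z fixed⇒z (divides k n≡k*2) = 2*z≢1 (+ k - X) (begin
  + 2 * (+ k - X)       ≡⟨ solve 2 (λ k X → con (+ 2) :* (k :- X) := k :* con (+ 2) :- X :- X) refl (+ k) X ⟩
  + k * + 2 - X - X     ≡⟨ cong (λ m → m - X - X) (trans (cong +_ n≡k*2) (ℤ.pos-* k 2)) ⟨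
  + n - X - X           ≡⟨ cong (λ m → m - X - X) n≡1+X+Y ⟩
  1ℤ + X + Y - X - X    ≡⟨ cong (λ y → 1ℤ + X + y - X - X) Y≡X ⟩
  1ℤ + X + X - X - X    ≡⟨ solve 1 (λ X → con 1ℤ :+ X :+ X :- X :- X := con 1ℤ) refl X ⟩
  1ℤ                    ∎)
  where
  open ≡-Reasoning
  X Y : ℤ
  X = sum (λ c → ⟦ c <? σ c ⟧)
  Y = sum (λ c → ⟦ σ c <? c ⟧)
  Y≡X : Y ≡ X
  Y≡X = trans (∑-permute (λ c → ⟦ σ c <? c ⟧) (permutation σ σ σ²≡id σ²≡id))
    (sum-cong-≗ (λ c → ⟦⟧-cong (σ (σ c) <? σ c) (c <? σ c)
      (subst (Fin._< σ c) (σ²≡id c)) (subst (Fin._< σ c) (sym (σ²≡id c)))))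
  trichotomy : ∀ c → ⟦ c ≟ z ⟧ + ⟦ c <? σ c ⟧ + ⟦ σ c <? c ⟧ ≡ 1ℤ
  trichotomy c with c ≟ z | <-cmp c (σ c)
  ... | yes refl | _ = cong₂ (λ x y → 1ℤ + x + y)
    (⟦no⟧ (c <? σ c) (<-irrefl (sym σz≡z))) (⟦no⟧ (σ c <? c) (<-irrefl σz≡z))
  ... | no c≢z | tri≈ _ c≡σc _ = ⊥-elim (c≢z (fixed⇒z (sym c≡σc)))
  ... | no _ | tri< c<σc _ σc≮c = cong₂ (λ x y → 0ℤ + x + y) (⟦yes⟧ (c <? σ c) c<σc) (⟦no⟧ (σ c <? c) σc≮c)
  ... | no _ | tri> c≮σc _ σc<c = cong₂ (λ x y → 0ℤ + x + y) (⟦no⟧ (c <? σ c) c≮σc) (⟦yes⟧ (σ c <? c) σc<c)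
  n≡1+X+Y : + n ≡ 1ℤ + X + Y
  n≡1+X+Y = begin
    + n                                                   ≡⟨ ∑-1 n ⟨
    sum {n} (λ _ → 1ℤ)                                    ≡⟨ sum-cong-≗ trichotomy ⟨
    sum (λ c → ⟦ c ≟ z ⟧ + ⟦ c <? σ c ⟧ + ⟦ σ c <? c ⟧)
      ≡⟨ ∑-distrib-+ (λ c → ⟦ c ≟ z ⟧ + ⟦ c <? σ c ⟧) (λ c → ⟦ σ c <? c ⟧) ⟩
    sum (λ c → ⟦ c ≟ z ⟧ + ⟦ c <? σ c ⟧) + Y
      ≡⟨ cong (_+ Y) (∑-distrib-+ (δ z) (λ c → ⟦ c <? σ c ⟧)) ⟩
    sum (δ z) + X + Y                                     ≡⟨ cong (λ x → x + X + Y) (∑-δ-const z) ⟩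
    1ℤ + X + Y                                            ∎

sumV≡sum : ∀ {n} (x : Vec ℤ n) → sumV x ≡ sum (lookup x)
sumV≡sum [] = refl
sumV≡sum (x ∷ xs) = cong (λ s → x + s) (sumV≡sum xs)

dot≡sum : ∀ {n} (x y : Vec ℤ n) → dot x y ≡ sum (λ i → lookup x i * lookup y i)
dot≡sum [] [] = refl
dot≡sum (x ∷ xs) (y ∷ ys) = cong (λ s → x * y + s) (dot≡sum xs ys)

sumL-map≡sum : ∀ {A : Set} (f : A → ℤ) (xs : List A) → sumL (List.map f xs) ≡ sum (λ k → f (List.lookup xs k))
sumL-map≡sum f [] = refl
sumL-map≡sum f (x ∷ xs) = cong (λ s → f x + s) (sumL-map≡sum f xs)

lookup-injective : ∀ {A : Set} {xs : List A} → Unique xs → ∀ {i j} → List.lookup xs i ≡ List.lookup xs j → i ≡ j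
lookup-injective (_ ∷ _) {zero} {zero} _ = refl
lookup-injective (x∉xs ∷ _) {zero} {suc j} x≡xsⱼ = ⊥-elim (All.lookup x∉xs (∈-lookup j) x≡xsⱼ)
lookup-injective (x∉xs ∷ _) {suc i} {zero} xsᵢ≡x = ⊥-elim (All.lookup x∉xs (∈-lookup i) (sym xsᵢ≡x))
lookup-injective (_ ∷ unique) {suc i} {suc j} eq = cong suc (lookup-injective unique eq)

differenceVec : ∀ {n} → Fin n → Fin n → Vec ℤ n
differenceVec t i = tabulate (λ j → δ t j - δ i j)

dot-differenceVec : ∀ {n} (x : Vec ℤ n) t i → dot x (differenceVec t i) ≡ lookup x t - lookup x i
dot-differenceVec x t i = begin
  dot x (differenceVec t i)
    ≡⟨ dot≡sum x (differenceVec t i) ⟩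
  sum (λ j → lookup x j * lookup (differenceVec t i) j)
    ≡⟨ sum-cong-≗ (λ j → trans (cong (lookup x j *_) (lookup∘tabulate _ j))
         (solve 3 (λ u v w → u :* (v :- w) := v :* u :- w :* u) refl (lookup x j) (δ t j) (δ i j))) ⟩
  sum (λ j → δ t j * lookup x j - δ i j * lookup x j)
    ≡⟨ ∑-distrib-- (λ j → δ t j * lookup x j) (λ j → δ i j * lookup x j) ⟩
  sum (λ j → δ t j * lookup x j) - sum (λ j → δ i j * lookup x j)
    ≡⟨ cong₂ _-_ (∑-δ t (lookup x)) (∑-δ i (lookup x)) ⟩
  lookup x t - lookup x i
    ∎
  where open ≡-Reasoning

norm²-differenceVec : ∀ {n} {t i : Fin n} → t ≢ i → norm² (differenceVec t i) ≡ + 2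
norm²-differenceVec {t = t} {i} t≢i = begin
  dot (differenceVec t i) (differenceVec t i)
    ≡⟨ dot-differenceVec (differenceVec t i) t i ⟩
  lookup (differenceVec t i) t - lookup (differenceVec t i) i
    ≡⟨ cong₂ _-_ (lookup∘tabulate _ t) (lookup∘tabulate _ i) ⟩
  (δ t t - δ i t) - (δ t i - δ i i)
    ≡⟨ cong₂ (λ u v → (δ t t - u) - (v - δ i i)) (δ-off t≢i) (δ-off (t≢i ∘ sym)) ⟩
  (δ t t - 0ℤ) - (0ℤ - δ i i)
    ≡⟨ cong₂ (λ u v → (u - 0ℤ) - (0ℤ - v)) (δ-diag t) (δ-diag i) ⟩
  + 2
    ∎
  where open ≡-Reasoning

sumV-differenceVec : ∀ {n} (t i : Fin n) → sumV (differenceVec t i) ≡ 0ℤ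
sumV-differenceVec t i = begin
  sumV (differenceVec t i)            ≡⟨ sumV≡sum (differenceVec t i) ⟩
  sum (lookup (differenceVec t i))    ≡⟨ sum-cong-≗ (lookup∘tabulate (λ j → δ t j - δ i j)) ⟩
  sum (λ j → δ t j - δ i j)           ≡⟨ ∑-distrib-- (δ t) (δ i) ⟩
  sum (δ t) - sum (δ i)               ≡⟨ cong₂ _-_ (∑-δ-const t) (∑-δ-const i) ⟩
  0ℤ                                  ∎
  where open ≡-Reasoning

module Design {m N : ℕ} .{{_ : ℕ.NonZero m}} (x : Fin N → Fin (suc m) → ℤ)
  (∑x≡0 : ∀ k → sum (x k) ≡ 0ℤ) (‖x‖²≡4 : ∀ k → ‖ x k ‖² ≡ + 4)
  (K : ℤ) (design : ∀ {t i} → t ≢ i → + m * sum (λ k → (x k t - x k i) * (x k t - x k i)) ≡ K) where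

  Q : Fin (suc m) → Fin (suc m) → ℤ
  Q t i = sum (λ k → (x k t - x k i) * (x k t - x k i))

  N² : Fin (suc m) → ℤ
  N² i = sum (λ k → x k i * x k i)

  C : Fin (suc m) → Fin (suc m) → ℤ
  C t i = sum (λ k → x k t * x k i)

  Q≡N²+N²-2C : ∀ t i → Q t i ≡ N² t + N² i - + 2 * C t i
  Q≡N²+N²-2C t i = begin
    Q t i
      ≡⟨ sum-cong-≗ (λ k → solve 2 (λ u v → (u :- v) :* (u :- v) := u :* u :+ v :* v :- con (+ 2) :* (u :* v))
                                   refl (x k t) (x k i)) ⟩
    sum (λ k → x k t * x k t + x k i * x k i - + 2 * (x k t * x k i))
      ≡⟨ ∑-distrib-- (λ k → x k t * x k t + x k i * x k i) (λ k → + 2 * (x k t * x k i)) ⟩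
    sum (λ k → x k t * x k t + x k i * x k i) - sum (λ k → + 2 * (x k t * x k i))
      ≡⟨ cong₂ _-_ (∑-distrib-+ (λ k → x k t * x k t) (λ k → x k i * x k i)) (∑-*ˡ (+ 2) (λ k → x k t * x k i)) ⟩
    N² t + N² i - + 2 * C t i
      ∎
    where open ≡-Reasoning

  ∑Q : ∀ i → sum (λ t → Q t i) ≡ + suc m * N² i + + 4 * + N
  ∑Q i = begin
    sum (λ t → Q t i)
      ≡⟨ ∑-comm (λ t k → (x k t - x k i) * (x k t - x k i)) ⟩
    sum (λ k → sum (λ t → (x k t - x k i) * (x k t - x k i)))
      ≡⟨ sum-cong-≗ (λ k → row k) ⟩
    sum (λ k → + suc m * (x k i * x k i) + + 4)
      ≡⟨ ∑-distrib-+ (λ k → + suc m * (x k i * x k i)) (λ _ → + 4) ⟩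
    sum (λ k → + suc m * (x k i * x k i)) + sum {N} (λ _ → + 4)
      ≡⟨ cong₂ _+_ (∑-*ˡ (+ suc m) (λ k → x k i * x k i)) (trans (∑-const N (+ 4)) (ℤ.*-comm (+ N) (+ 4))) ⟩
    + suc m * N² i + + 4 * + N
      ∎
    where
    open ≡-Reasoning
    row : ∀ k → sum (λ t → (x k t - x k i) * (x k t - x k i)) ≡ + suc m * (x k i * x k i) + + 4
    row k = begin
      sum (λ t → (x k t - x k i) * (x k t - x k i))
        ≡⟨ sum-cong-≗ (λ t → solve 2 (λ u v → (u :- v) :* (u :- v) := u :* u :- con (+ 2) :* v :* u :+ v :* v)
                                     refl (x k t) (x k i)) ⟩
      sum (λ t → x k t * x k t - + 2 * x k i * x k t + x k i * x k i)
        ≡⟨ ∑-distrib-+ (λ t → x k t * x k t - + 2 * x k i * x k t) (λ _ → x k i * x k i) ⟩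
      sum (λ t → x k t * x k t - + 2 * x k i * x k t) + sum {suc m} (λ _ → x k i * x k i)
        ≡⟨ cong₂ _+_ (∑-distrib-- (λ t → x k t * x k t) (λ t → + 2 * x k i * x k t)) (∑-const (suc m) (x k i * x k i)) ⟩
      ‖ x k ‖² - sum (λ t → + 2 * x k i * x k t) + + suc m * (x k i * x k i)
        ≡⟨ cong₂ (λ u v → u - v + + suc m * (x k i * x k i)) (‖x‖²≡4 k)
             (trans (∑-*ˡ (+ 2 * x k i) (x k)) (trans (cong (+ 2 * x k i *_) (∑x≡0 k)) (ℤ.*-zeroʳ (+ 2 * x k i)))) ⟩
      + 4 - 0ℤ + + suc m * (x k i * x k i)
        ≡⟨ solve 1 (λ y → con (+ 4) :- con 0ℤ :+ y := y :+ con (+ 4)) refl (+ suc m * (x k i * x k i)) ⟩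
      + suc m * (x k i * x k i) + + 4
        ∎

  ∑Q≡K : ∀ i → sum (λ t → Q t i) ≡ K
  ∑Q≡K i = ℤ.*-cancelˡ-≡ (+ m) _ _ (begin
    + m * sum (λ t → Q t i)             ≡⟨ ∑-*ˡ (+ m) (λ t → Q t i) ⟨
    sum (λ t → + m * Q t i)             ≡⟨ sum-cong-≗ mQ ⟩
    sum (λ t → K - δ i t * K)           ≡⟨ ∑-distrib-- (λ _ → K) (λ t → δ i t * K) ⟩
    sum {suc m} (λ _ → K) - sum (λ t → δ i t * K) ≡⟨ cong₂ _-_ (∑-const (suc m) K) (∑-δ i (λ _ → K)) ⟩
    + suc m * K - K                     ≡⟨ solve 2 (λ m K → (con 1ℤ :+ m) :* K :- K := m :* K) refl (+ m) K ⟩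
    + m * K                             ∎)
    where
    open ≡-Reasoning
    mQ : ∀ t → + m * Q t i ≡ K - δ i t * K
    mQ t with t ≟ i
    ... | yes refl = begin
      + m * Q t t                  ≡⟨ cong (+ m *_) (sum-cong-≗ (λ k → cong (λ u → u * u) (ℤ.+-inverseʳ (x k t)))) ⟩
      + m * sum {N} (λ _ → 0ℤ)     ≡⟨ cong (+ m *_) (sum-replicate-zero N) ⟩
      + m * 0ℤ                     ≡⟨ ℤ.*-zeroʳ (+ m) ⟩
      0ℤ                           ≡⟨ ℤ.+-inverseʳ K ⟨
      K - K                        ≡⟨ cong (λ v → K - v) (ℤ.*-identityˡ K) ⟨
      K - 1ℤ * K                   ∎
    ... | no t≢i = trans (design t≢i) (sym (trans (cong (λ v → K - v) (ℤ.*-zeroˡ K)) (ℤ.+-identityʳ K)))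

  N²-constant : ∀ t u → N² t ≡ N² u
  N²-constant t u = ℤ.*-cancelˡ-≡ (+ suc m) _ _
    (+-cancelʳ-≡ _ _ _ (trans (sym (∑Q t)) (trans (∑Q≡K t) (trans (sym (∑Q≡K u)) (∑Q u)))))

  correlation-constant : ∀ {i t u} → t ≢ i → u ≢ i → C t i ≡ C u i
  correlation-constant {i} {t} {u} t≢i u≢i =
    ℤ.*-cancelˡ-≡ (+ 2) _ _ (ℤ.neg-injective (+-cancelˡ-≡ (N² t + N² i) _ _ (begin
    N² t + N² i - + 2 * C t i     ≡⟨ Q≡N²+N²-2C t i ⟨
    Q t i                         ≡⟨ ℤ.*-cancelˡ-≡ (+ m) _ _ (trans (design t≢i) (sym (design u≢i))) ⟩
    Q u i                         ≡⟨ Q≡N²+N²-2C u i ⟩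
    N² u + N² i - + 2 * C u i     ≡⟨ cong (λ v → v + N² i - + 2 * C u i) (N²-constant u t) ⟩
    N² t + N² i - + 2 * C u i     ∎)))
    where open ≡-Reasoning

module FiniteAbelianGroup {n : ℕ} {op : Op₂ (Fin n)} {e : Fin n} {inv : Op₁ (Fin n)}
  (isAbelianGroup : IsAbelianGroup _≡_ op e inv) where

  private
    A : AbelianGroup 0ℓ 0ℓ
    A = record { isAbelianGroup = isAbelianGroup }

  open AbelianGroup A using (_∙_; ε; _⁻¹; assoc; comm; identityˡ; identityʳ; inverseˡ; inverseʳ)
  open import Algebra.Properties.AbelianGroup A
    using (∙-cancelˡ; ∙-cancelʳ; ⁻¹-involutive; ε⁻¹≈ε; identityˡ-unique; identityʳ-unique; xyx⁻¹≈y; ⁻¹-∙-comm)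
  open import Algebra.Properties.CommutativeSemigroup (AbelianGroup.commutativeSemigroup A)
    using (interchange)

  x∙y⁻¹∙y≡x : ∀ x y → x ∙ y ⁻¹ ∙ y ≡ x
  x∙y⁻¹∙y≡x x y = trans (assoc x (y ⁻¹) y) (trans (cong (x ∙_) (inverseˡ y)) (identityʳ x))

  x∙y∙y⁻¹≡x : ∀ x y → x ∙ y ∙ y ⁻¹ ≡ x
  x∙y∙y⁻¹≡x x y = trans (assoc x y (y ⁻¹)) (trans (cong (x ∙_) (inverseʳ y)) (identityʳ x))

  #roots : Fin n → ℤ
  #roots s = sum (λ c → ⟦ c ∙ c ≟ s ⟧)

  #roots-translate : ∀ {c₀ s} → c₀ ∙ c₀ ≡ s → #roots s ≡ #roots ε
  #roots-translate {c₀} {s} c₀²≡s = trans (∑-permute (λ c → ⟦ c ∙ c ≟ s ⟧) translate)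
    (sum-cong-≗ (λ c → ⟦⟧-cong (_ ≟ s) (c ∙ c ≟ ε) (shifted⇒ c) (⇒shifted c)))
    where
    translate : Permutation n n
    translate = permutation (_∙ c₀) (_∙ c₀ ⁻¹) (λ c → x∙y⁻¹∙y≡x c c₀) (λ c → x∙y∙y⁻¹≡x c c₀)
    square : ∀ c → (c ∙ c₀) ∙ (c ∙ c₀) ≡ (c ∙ c) ∙ s
    square c = trans (interchange c c₀ c c₀) (cong ((c ∙ c) ∙_) c₀²≡s)
    shifted⇒ : ∀ c → (c ∙ c₀) ∙ (c ∙ c₀) ≡ s → c ∙ c ≡ ε
    shifted⇒ c eq = ∙-cancelʳ s (c ∙ c) ε (trans (sym (square c)) (trans eq (sym (identityˡ s))))
    ⇒shifted : ∀ c → c ∙ c ≡ ε → (c ∙ c₀) ∙ (c ∙ c₀) ≡ s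
    ⇒shifted c c²≡ε = trans (square c) (trans (cong (_∙ s) c²≡ε) (identityˡ s))

  #roots-nonsquare : ∀ {s} → (∀ c → c ∙ c ≢ s) → #roots s ≡ 0ℤ
  #roots-nonsquare {s} nonsquare = trans (sum-cong-≗ (λ c → ⟦no⟧ (c ∙ c ≟ s) (nonsquare c))) (sum-replicate-zero n)

  even⇒∃involution : 2 ∣ n → ∃ λ h → h ≢ ε × h ∙ h ≡ ε
  even⇒∃involution 2∣n with any? (λ h → ¬? (h ≟ ε) ×-dec (h ∙ h ≟ ε))
  ... | yes involution = involution
  ... | no ¬involution = ⊥-elim (unique-fixed-point⇒odd _⁻¹ ⁻¹-involutive ε⁻¹≈ε self-inverse⇒ε 2∣n)
    where
    self-inverse⇒ε : ∀ {c} → c ⁻¹ ≡ c → c ≡ ε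
    self-inverse⇒ε {c} c⁻¹≡c with c ≟ ε
    ... | yes c≡ε = c≡ε
    ... | no c≢ε = ⊥-elim (¬involution (c , c≢ε , trans (cong (c ∙_) (sym c⁻¹≡c)) (inverseʳ c)))

  record Balanced (a b c d : Fin n) : Set where
    constructor balanced
    field
      distinct : Distinct4 a b c d
      relation : a ∙ b ≡ c ∙ d

  balanced? : ∀ a b c d → Dec (Balanced a b c d)
  balanced? a b c d = map′ (λ (D , ab≡cd) → balanced D ab≡cd) (λ (balanced D ab≡cd) → D , ab≡cd)
    (distinct4? a b c d ×-dec (a ∙ b ≟ c ∙ d))

  β : Fin n → Fin n → Fin n → Fin n → ℤ
  β a b c d = ⟦ balanced? a b c d ⟧

  balanced-swapᵃᵇ : ∀ {a b c d} → Balanced a b c d → Balanced b a c d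
  balanced-swapᵃᵇ {a} {b} (balanced D ab≡cd) = balanced (distinct4-swapᵃᵇ D) (trans (comm b a) ab≡cd)

  balanced-swapᶜᵈ : ∀ {a b c d} → Balanced a b c d → Balanced a b d c
  balanced-swapᶜᵈ {c = c} {d} (balanced D ab≡cd) = balanced (distinct4-swapᶜᵈ D) (trans ab≡cd (comm c d))

  balanced-swap-pairs : ∀ {a b c d} → Balanced a b c d → Balanced c d a b
  balanced-swap-pairs (balanced D ab≡cd) = balanced (distinct4-swap-pairs D) (sym ab≡cd)

  β-swapᵃᵇ : ∀ a b c d → β b a c d ≡ β a b c d
  β-swapᵃᵇ a b c d = ⟦⟧-cong (balanced? b a c d) (balanced? a b c d) balanced-swapᵃᵇ balanced-swapᵃᵇ

  β-swapᶜᵈ : ∀ a b c d → β a b d c ≡ β a b c d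
  β-swapᶜᵈ a b c d = ⟦⟧-cong (balanced? a b d c) (balanced? a b c d) balanced-swapᶜᵈ balanced-swapᶜᵈ

  β-swap-pairs : ∀ a b c d → β c d a b ≡ β a b c d
  β-swap-pairs a b c d = ⟦⟧-cong (balanced? c d a b) (balanced? a b c d) balanced-swap-pairs balanced-swap-pairs

  Completable : Fin n → Fin n → Set
  Completable x y = x ≢ ε × y ≢ ε × x ≢ y × y ∙ y ≢ x

  completable? : ∀ x y → Dec (Completable x y)
  completable? x y = ¬? (x ≟ ε) ×-dec ¬? (y ≟ ε) ×-dec ¬? (x ≟ y) ×-dec ¬? (y ∙ y ≟ x)

  ∑-β-ε : ∀ x y → sum (β ε x y) ≡ ⟦ completable? x y ⟧
  ∑-β-ε x y = ∑-⟦⟧-unique (balanced? ε x y) (completable? x y) (y ⁻¹ ∙ x) balanced⇒ (⇒balanced y∙[y⁻¹∙x]≡x)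
    where
    y∙[y⁻¹∙x]≡x : y ∙ (y ⁻¹ ∙ x) ≡ x
    y∙[y⁻¹∙x]≡x = trans (sym (assoc y (y ⁻¹) x)) (trans (cong (_∙ x) (inverseʳ y)) (identityˡ x))
    balanced⇒ : ∀ {d} → Balanced ε x y d → d ≡ y ⁻¹ ∙ x × Completable x y
    balanced⇒ {d} (balanced (distinct4 ε≢x ε≢y _ x≢y _ y≢d) εx≡yd) =
      ∙-cancelˡ y d (y ⁻¹ ∙ x) (trans yd≡x (sym y∙[y⁻¹∙x]≡x)) ,
      ε≢x ∘ sym , ε≢y ∘ sym , x≢y , λ yy≡x → y≢d (∙-cancelˡ y y d (trans yy≡x (sym yd≡x)))
      where
      yd≡x : y ∙ d ≡ x
      yd≡x = trans (sym εx≡yd) (identityˡ x)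
    ⇒balanced : ∀ {z} → y ∙ z ≡ x → Completable x y → Balanced ε x y z
    ⇒balanced {z} yz≡x (x≢ε , y≢ε , x≢y , yy≢x) =
      balanced (distinct4 (x≢ε ∘ sym) (y≢ε ∘ sym) ε≢z x≢y x≢z y≢z) (trans (identityˡ x) (sym yz≡x))
      where
      ε≢z : ε ≢ z
      ε≢z refl = x≢y (trans (sym yz≡x) (identityʳ y))
      x≢z : x ≢ z
      x≢z refl = y≢ε (identityˡ-unique y x yz≡x)
      y≢z : y ≢ z
      y≢z refl = yy≢x yz≡x

  ∑²-β-ε-first : ∀ {t} → t ≢ ε → ∑² (β ε t) ≡ + n - 1ℤ - 1ℤ - #roots t
  ∑²-β-ε-first {t} t≢ε = begin
    ∑² (β ε t)
      ≡⟨ sum-cong-≗ (λ c → trans (∑-β-ε t c)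
           (⟦⟧-cong (completable? t c) (¬? (c ≟ ε) ×-dec ¬? (c ≟ t) ×-dec ¬? (c ∙ c ≟ t))
           (λ (_ , c≢ε , t≢c , cc≢t) → c≢ε , t≢c ∘ sym , cc≢t)
           (λ (c≢ε , c≢t , cc≢t) → t≢ε , c≢ε , c≢t ∘ sym , cc≢t))) ⟩
    sum (λ c → ⟦ ¬? (c ≟ ε) ×-dec ¬? (c ≟ t) ×-dec ¬? (c ∙ c ≟ t) ⟧)
      ≡⟨ ∑-none-of-3 (_≟ ε) (_≟ t) (λ c → c ∙ c ≟ t)
           (λ { refl refl → t≢ε refl }) (λ { refl εε≡t → t≢ε (trans (sym εε≡t) (identityˡ ε)) })
           (λ { refl tt≡t → t≢ε (identityˡ-unique t t tt≡t) }) ⟩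
    + n - sum (δ ε) - sum (δ t) - #roots t
      ≡⟨ cong₂ (λ x y → + n - x - y - #roots t) (∑-δ-const ε) (∑-δ-const t) ⟩
    + n - 1ℤ - 1ℤ - #roots t
      ∎
    where open ≡-Reasoning

  ∑²-β-ε-second : ∀ {t} → t ≢ ε → ∑² (λ b d → β ε b t d) ≡ + n - + 3 + ⟦ t ∙ t ≟ ε ⟧
  ∑²-β-ε-second {t} t≢ε with t ∙ t ≟ ε
  ... | yes t²≡ε = begin
    ∑² (λ b d → β ε b t d)
      ≡⟨ sum-cong-≗ (λ b → trans (∑-β-ε b t) (⟦⟧-cong (completable? b t) (¬? (b ≟ ε) ×-dec ¬? (b ≟ t))
           (λ (b≢ε , _ , b≢t , _) → b≢ε , b≢t)
           (λ (b≢ε , b≢t) → b≢ε , t≢ε , b≢t , λ tt≡b → b≢ε (trans (sym tt≡b) t²≡ε)))) ⟩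
    sum (λ b → ⟦ ¬? (b ≟ ε) ×-dec ¬? (b ≟ t) ⟧)
      ≡⟨ ∑-none-of-2 (_≟ ε) (_≟ t) (λ { refl refl → t≢ε refl }) ⟩
    + n - sum (δ ε) - sum (δ t)
      ≡⟨ cong₂ (λ x y → + n - x - y) (∑-δ-const ε) (∑-δ-const t) ⟩
    + n - 1ℤ - 1ℤ
      ≡⟨ solve 1 (λ m → m :- con 1ℤ :- con 1ℤ := m :- con (+ 3) :+ con 1ℤ) refl (+ n) ⟩
    + n - + 3 + 1ℤ
      ∎
    where open ≡-Reasoning
  ... | no t²≢ε = begin
    ∑² (λ b d → β ε b t d)
      ≡⟨ sum-cong-≗ (λ b → trans (∑-β-ε b t)
           (⟦⟧-cong (completable? b t) (¬? (b ≟ ε) ×-dec ¬? (b ≟ t) ×-dec ¬? (b ≟ t ∙ t))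
           (λ (b≢ε , _ , b≢t , tt≢b) → b≢ε , b≢t , tt≢b ∘ sym)
           (λ (b≢ε , b≢t , b≢tt) → b≢ε , t≢ε , b≢t , b≢tt ∘ sym))) ⟩
    sum (λ b → ⟦ ¬? (b ≟ ε) ×-dec ¬? (b ≟ t) ×-dec ¬? (b ≟ t ∙ t) ⟧)
      ≡⟨ ∑-none-of-3 (_≟ ε) (_≟ t) (_≟ t ∙ t)
           (λ { refl refl → t≢ε refl }) (λ { refl ε≡tt → t²≢ε (sym ε≡tt) })
           (λ { refl t≡tt → t≢ε (identityˡ-unique t t (sym t≡tt)) }) ⟩
    + n - sum (δ ε) - sum (δ t) - sum (δ (t ∙ t))
      ≡⟨ cong₂ (λ x y → + n - x - y - sum (δ (t ∙ t))) (∑-δ-const ε) (∑-δ-const t) ⟩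
    + n - 1ℤ - 1ℤ - sum (δ (t ∙ t))
      ≡⟨ cong (λ z → + n - 1ℤ - 1ℤ - z) (∑-δ-const (t ∙ t)) ⟩
    + n - 1ℤ - 1ℤ - 1ℤ
      ≡⟨ solve 1 (λ m → m :- con 1ℤ :- con 1ℤ :- con 1ℤ := m :- con (+ 3) :+ con 0ℤ) refl (+ n) ⟩
    + n - + 3 + 0ℤ
      ∎
    where open ≡-Reasoning

  balancedMoment : Fin n → ℤ
  balancedMoment t = ∑⁴ (λ a b c d → β a b c d * quad a b c d t * quad a b c d ε)

  ∑³-β-ε-quad : ∀ {t} → t ≢ ε →
    ∑³ (λ b c d → β ε b c d * quad ε b c d t) ≡ ∑² (β ε t) - ∑² (λ b d → β ε b t d) - ∑² (λ b d → β ε b t d)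
  ∑³-β-ε-quad {t} t≢ε = begin
    ∑³ (λ b c d → β ε b c d * quad ε b c d t)
      ≡⟨ ∑³-cong (λ b c d → trans (cong (λ x → β ε b c d * (x + δ b t - δ c t - δ d t)) (δ-off t≢ε))
           (solve 4 (λ v y z w → v :* (con 0ℤ :+ y :- z :- w) := v :* y :- v :* z :- v :* w) refl
              (β ε b c d) (δ b t) (δ c t) (δ d t))) ⟩
    ∑³ (λ b c d → β ε b c d * δ b t - β ε b c d * δ c t - β ε b c d * δ d t)
      ≡⟨ ∑³-distrib-- (λ b c d → β ε b c d * δ b t - β ε b c d * δ c t) (λ b c d → β ε b c d * δ d t) ⟩
    ∑³ (λ b c d → β ε b c d * δ b t - β ε b c d * δ c t) - ∑³ (λ b c d → β ε b c d * δ d t)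
      ≡⟨ cong (_- ∑³ (λ b c d → β ε b c d * δ d t))
           (∑³-distrib-- (λ b c d → β ε b c d * δ b t) (λ b c d → β ε b c d * δ c t)) ⟩
    ∑³ (λ b c d → β ε b c d * δ b t) - ∑³ (λ b c d → β ε b c d * δ c t) - ∑³ (λ b c d → β ε b c d * δ d t)
      ≡⟨ cong₂ (λ x y → x - y - ∑³ (λ b c d → β ε b c d * δ d t)) (∑³-δᵃ (β ε) t) (∑³-δᵇ (β ε) t) ⟩
    ∑² (β ε t) - ∑² (λ b d → β ε b t d) - ∑³ (λ b c d → β ε b c d * δ d t)
      ≡⟨ cong (λ z → ∑² (β ε t) - ∑² (λ b d → β ε b t d) - z)
           (trans (∑³-δᶜ (β ε) t) (∑²-cong (λ b c → β-swapᶜᵈ ε b t c))) ⟩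
    ∑² (β ε t) - ∑² (λ b d → β ε b t d) - ∑² (λ b d → β ε b t d)
      ∎
    where open ≡-Reasoning

  balancedMoment-formula : ∀ {t} → t ≢ ε → balancedMoment t ≡ + 4 * (+ 4 - + n - (#roots t + + 2 * ⟦ t ∙ t ≟ ε ⟧))
  balancedMoment-formula {t} t≢ε = begin
    balancedMoment t
      ≡⟨ ∑⁴-quad-weight (λ a b c d → β a b c d * quad a b c d t) ε
           (λ a b c d → cong₂ _*_ (β-swapᵃᵇ a b c d) (quad-swapᵃᵇ a b c d t))
           (λ a b c d → cong₂ _*_ (β-swapᶜᵈ a b c d) (quad-swapᶜᵈ a b c d t))
           (λ a b c d → trans (cong₂ _*_ (β-swap-pairs a b c d) (quad-swap-pairs a b c d t))
                              (sym (ℤ.neg-distribʳ-* (β a b c d) (quad a b c d t)))) ⟩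
    + 4 * ∑⁴ (λ a b c d → β a b c d * quad a b c d t * δ a ε)
      ≡⟨ cong (+ 4 *_) (trans (∑⁴-δᵃ (λ a b c d → β a b c d * quad a b c d t) ε) (∑³-β-ε-quad t≢ε)) ⟩
    + 4 * (∑² (β ε t) - ∑² (λ b d → β ε b t d) - ∑² (λ b d → β ε b t d))
      ≡⟨ cong₂ (λ x y → + 4 * (x - y - y)) (∑²-β-ε-first t≢ε) (∑²-β-ε-second t≢ε) ⟩
    + 4 * (+ n - 1ℤ - 1ℤ - #roots t - (+ n - + 3 + ⟦ t ∙ t ≟ ε ⟧) - (+ n - + 3 + ⟦ t ∙ t ≟ ε ⟧))
      ≡⟨ solve 3 (λ m r k → con (+ 4) :* (m :- con 1ℤ :- con 1ℤ :- r :- (m :- con (+ 3) :+ k) :- (m :- con (+ 3) :+ k))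
                          := con (+ 4) :* (con (+ 4) :- m :- (r :+ con (+ 2) :* k)))
           refl (+ n) (#roots t) ⟦ t ∙ t ≟ ε ⟧ ⟩
    + 4 * (+ 4 - + n - (#roots t + + 2 * ⟦ t ∙ t ≟ ε ⟧))
      ∎
    where open ≡-Reasoning

  #roots-nonneg : ∀ s → 0ℤ ≤ #roots s
  #roots-nonneg s = ∑-nonneg _ (λ c → ⟦⟧-nonneg (c ∙ c ≟ s))

  #roots-dichotomy : ∀ s → #roots s ≡ 0ℤ ⊎ ∃ λ c → c ∙ c ≡ s
  #roots-dichotomy s with any? (λ c → c ∙ c ≟ s)
  ... | yes square = inj₂ square
  ... | no ¬square = inj₁ (#roots-nonsquare (λ c c²≡s → ¬square (c , c²≡s)))

  nontrivial : ∀ {t} → t ∙ t ≢ ε → t ≢ ε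
  nontrivial t²≢ε refl = t²≢ε (identityˡ _)

  balancedMoment≡⇒#roots-shift : ∀ {t h} → t ∙ t ≢ ε → h ≢ ε → h ∙ h ≡ ε →
                                 balancedMoment t ≡ balancedMoment h → #roots t ≡ #roots h + + 2
  balancedMoment≡⇒#roots-shift {t} {h} t²≢ε h≢ε h²≡ε moment-t≡moment-h =
    trans (sym (ℤ.+-identityʳ (#roots t))) (ℤ.neg-injective (+-cancelˡ-≡ (+ 4 - + n) _ _ (begin
      + 4 - + n - (#roots t + + 2 * 0ℤ)
        ≡⟨ cong (λ k → + 4 - + n - (#roots t + + 2 * k)) (⟦no⟧ (t ∙ t ≟ ε) t²≢ε) ⟨
      + 4 - + n - (#roots t + + 2 * ⟦ t ∙ t ≟ ε ⟧)
        ≡⟨ ℤ.*-cancelˡ-≡ (+ 4) _ _ (trans (sym (balancedMoment-formula (nontrivial t²≢ε)))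
                                        (trans moment-t≡moment-h (balancedMoment-formula h≢ε))) ⟩
      + 4 - + n - (#roots h + + 2 * ⟦ h ∙ h ≟ ε ⟧)
        ≡⟨ cong (λ k → + 4 - + n - (#roots h + + 2 * k)) (⟦yes⟧ (h ∙ h ≟ ε) h²≡ε) ⟩
      + 4 - + n - (#roots h + + 2)
        ∎)))
    where open ≡-Reasoning

  #roots-not-shifted : ∀ {h a} → h ∙ h ≡ ε → a ∙ a ≢ ε → ¬ (∀ {t} → t ∙ t ≢ ε → #roots t ≡ #roots h + + 2)
  #roots-not-shifted {h} {a} h²≡ε a²≢ε shift = case +-identityʳ-unique _ _ (sym #roots-ε≡#roots-ε+2) of λ ()
    where
    square : ∀ {t} → t ∙ t ≢ ε → ∃ λ c → c ∙ c ≡ t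
    square {t} t²≢ε with #roots-dichotomy t
    ... | inj₂ root = root
    ... | inj₁ #roots-t≡0 = ⊥-elim (ℤ.<-irrefl (trans (sym #roots-t≡0) (shift t²≢ε))
                              (ℤ.+-mono-≤-< (#roots-nonneg h) (+<+ (s≤s z≤n))))
    [ah]²≢ε : (a ∙ h) ∙ (a ∙ h) ≢ ε
    [ah]²≢ε [ah]²≡ε =
      a²≢ε (trans (sym (trans (interchange a h a h) (trans (cong ((a ∙ a) ∙_) h²≡ε) (identityʳ _)))) [ah]²≡ε)
    h-square : ∃ λ c → c ∙ c ≡ h
    h-square with square a²≢ε | square [ah]²≢ε
    ... | c₁ , c₁²≡a | c₂ , c₂²≡ah = c₂ ∙ c₁ ⁻¹ , (begin
      (c₂ ∙ c₁ ⁻¹) ∙ (c₂ ∙ c₁ ⁻¹)   ≡⟨ interchange c₂ (c₁ ⁻¹) c₂ (c₁ ⁻¹) ⟩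
      (c₂ ∙ c₂) ∙ (c₁ ⁻¹ ∙ c₁ ⁻¹)   ≡⟨ cong ((c₂ ∙ c₂) ∙_) (⁻¹-∙-comm c₁ c₁) ⟩
      (c₂ ∙ c₂) ∙ (c₁ ∙ c₁) ⁻¹       ≡⟨ cong₂ (λ x y → x ∙ y ⁻¹) c₂²≡ah c₁²≡a ⟩
      (a ∙ h) ∙ a ⁻¹                  ≡⟨ xyx⁻¹≈y a h ⟩
      h                               ∎)
      where open ≡-Reasoning
    #roots-ε≡#roots-ε+2 : #roots ε ≡ #roots ε + + 2
    #roots-ε≡#roots-ε+2 = begin
      #roots ε        ≡⟨ #roots-translate (proj₂ (square a²≢ε)) ⟨
      #roots a        ≡⟨ shift a²≢ε ⟩
      #roots h + + 2  ≡⟨ cong (_+ + 2) (#roots-translate (proj₂ h-square)) ⟩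
      #roots ε + + 2  ∎
      where open ≡-Reasoning

  balancedMoment-nonconstant : 2 ∣ n → (∃ λ a → a ∙ a ≢ ε) →
                               ¬ (∀ {t u} → t ≢ ε → u ≢ ε → balancedMoment t ≡ balancedMoment u)
  balancedMoment-nonconstant 2∣n (a , a²≢ε) balancedMoment-constant with even⇒∃involution 2∣n
  ... | h , h≢ε , h²≡ε = #roots-not-shifted h²≡ε a²≢ε
    (λ t²≢ε → balancedMoment≡⇒#roots-shift t²≢ε h≢ε h²≡ε (balancedMoment-constant (nontrivial t²≢ε) h≢ε))

  record QuadRep (x : Vec ℤ n) : Set where
    constructor quadRep
    field
      {a b c d} : Fin n
      isBalanced : Balanced a b c d
      x≡quadVec : x ≡ quadVec a b c d

  samePairs⇒representation : ∀ {p r q s a b c d} → Balanced p r q s → SamePair p r a b × SamePair q s c d →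
                             Balanced a b c d × quadVec a b c d ≡ quadVec p r q s
  samePairs⇒representation B (inj₁ (refl , refl) , inj₁ (refl , refl)) = B , refl
  samePairs⇒representation {p} {r} {q} {s} B (inj₂ (refl , refl) , inj₁ (refl , refl)) =
    balanced-swapᵃᵇ B , tabulate-cong (quad-swapᵃᵇ p r q s)
  samePairs⇒representation {p} {r} {q} {s} B (inj₁ (refl , refl) , inj₂ (refl , refl)) =
    balanced-swapᶜᵈ B , tabulate-cong (quad-swapᶜᵈ p r q s)
  samePairs⇒representation {p} {r} {q} {s} B (inj₂ (refl , refl) , inj₂ (refl , refl)) =
    balanced-swapᶜᵈ (balanced-swapᵃᵇ B) , tabulate-cong (λ i → trans (quad-swapᶜᵈ r p q s i) (quad-swapᵃᵇ p r q s i))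

  ∑⁴-representations : ∀ {x} → QuadRep x → ∑⁴ (λ a b c d → β a b c d * ⟦ quadVec a b c d ≟ᵥ x ⟧) ≡ + 4
  ∑⁴-representations (quadRep {p} {r} {q} {s} B@(balanced D _) refl) = begin
    ∑⁴ (λ a b c d → β a b c d * ⟦ quadVec a b c d ≟ᵥ quadVec p r q s ⟧)
      ≡⟨ ∑⁴-cong (λ a b c d → trans (⟦×⟧ (balanced? a b c d) (quadVec a b c d ≟ᵥ quadVec p r q s))
           (trans (⟦⟧-cong (balanced? a b c d ×-dec (quadVec a b c d ≟ᵥ quadVec p r q s))
                           (samePair? p r a b ×-dec samePair? q s c d)
                           (λ (balanced D′ _ , quads≡) → quadVec≡⇒samePairs D′ quads≡)
                           (samePairs⇒representation B))
                  (sym (⟦×⟧ (samePair? p r a b) (samePair? q s c d))))) ⟩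
    ∑⁴ (λ a b c d → ⟦ samePair? p r a b ⟧ * ⟦ samePair? q s c d ⟧)
      ≡⟨ ∑⁴-separable (λ a b → ⟦ samePair? p r a b ⟧) (λ c d → ⟦ samePair? q s c d ⟧) ⟩
    ∑² (λ a b → ⟦ samePair? p r a b ⟧) * ∑² (λ c d → ⟦ samePair? q s c d ⟧)
      ≡⟨ cong₂ _*_ (∑²-samePair (Distinct4.a≢b D)) (∑²-samePair (Distinct4.c≢d D)) ⟩
    + 4
      ∎
    where open ≡-Reasoning

  module _ {N : ℕ} (s : Fin N → Vec ℤ n) (s-injective : ∀ {k l} → s k ≡ s l → k ≡ l)
    (s-quad : ∀ k → QuadRep (s k)) (quad-s : ∀ {a b c d} → Balanced a b c d → ∃ λ k → s k ≡ quadVec a b c d) where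

    ∑-via-quadruples : ∀ (F : Vec ℤ n → ℤ) →
      + 4 * sum (λ k → F (s k)) ≡ ∑⁴ (λ a b c d → β a b c d * F (quadVec a b c d))
    ∑-via-quadruples F = sym (begin
      ∑⁴ (λ a b c d → β a b c d * F (quadVec a b c d))
        ≡⟨ ∑⁴-cong (λ a b c d → hit (balanced? a b c d)) ⟩
      ∑⁴ (λ a b c d → sum (λ k → β a b c d * ⟦ quadVec a b c d ≟ᵥ s k ⟧ * F (s k)))
        ≡⟨ ∑⁴-comm-sum (λ k a b c d → β a b c d * ⟦ quadVec a b c d ≟ᵥ s k ⟧ * F (s k)) ⟩
      sum (λ k → ∑⁴ (λ a b c d → β a b c d * ⟦ quadVec a b c d ≟ᵥ s k ⟧ * F (s k)))
        ≡⟨ sum-cong-≗ (λ k → ∑⁴-*ʳ (λ a b c d → β a b c d * ⟦ quadVec a b c d ≟ᵥ s k ⟧) (F (s k))) ⟩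
      sum (λ k → ∑⁴ (λ a b c d → β a b c d * ⟦ quadVec a b c d ≟ᵥ s k ⟧) * F (s k))
        ≡⟨ sum-cong-≗ (λ k → cong (_* F (s k)) (∑⁴-representations (s-quad k))) ⟩
      sum (λ k → + 4 * F (s k))
        ≡⟨ ∑-*ˡ (+ 4) (λ k → F (s k)) ⟩
      + 4 * sum (λ k → F (s k))
        ∎)
      where
      open ≡-Reasoning
      hit : ∀ {a b c d} (B? : Dec (Balanced a b c d)) →
            ⟦ B? ⟧ * F (quadVec a b c d) ≡ sum (λ k → ⟦ B? ⟧ * ⟦ quadVec a b c d ≟ᵥ s k ⟧ * F (s k))
      hit (no _) = sym (sum-replicate-zero N)
      hit {a} {b} {c} {d} (yes B) with quad-s B
      ... | k₀ , sk₀≡q = begin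
        1ℤ * F (quadVec a b c d)                                   ≡⟨ ℤ.*-identityˡ _ ⟩
        F (quadVec a b c d)                                        ≡⟨ cong F sk₀≡q ⟨
        F (s k₀)                                                   ≡⟨ ∑-δ k₀ (λ k → F (s k)) ⟨
        sum (λ k → δ k₀ k * F (s k))                               ≡⟨ sum-cong-≗ (λ k → cong₂ _*_ (same k) refl) ⟩
        sum (λ k → 1ℤ * ⟦ quadVec a b c d ≟ᵥ s k ⟧ * F (s k))      ∎
        where
        same : ∀ k → δ k₀ k ≡ 1ℤ * ⟦ quadVec a b c d ≟ᵥ s k ⟧
        same k = trans (⟦⟧-cong (k ≟ k₀) (quadVec a b c d ≟ᵥ s k)
                         (λ { refl → sym sk₀≡q }) (λ q≡sk → s-injective (trans (sym q≡sk) (sym sk₀≡q))))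
                       (sym (ℤ.*-identityˡ _))

  span : ∀ {k} → Vec (Fin n) k → Vec Bool k → Fin n
  span [] [] = ε
  span (x ∷ B) (b ∷ v) = (if b then x else ε) ∙ span B v

  SpanInjective : ∀ {k} → Vec (Fin n) k → Set
  SpanInjective B = ∀ {v w} → span B v ≡ span B w → v ≡ w

  span-injective⇒≤ : ∀ {k} (B : Vec (Fin n) k) → SpanInjective B → k ℕ.≤ n
  span-injective⇒≤ B injective = injective⇒≤ (unitVec-injective ∘ injective)

  module _ (elementary : ∀ a → a ∙ a ≡ ε) where

    x∙y∙y≡x : ∀ x y → x ∙ y ∙ y ≡ x
    x∙y∙y≡x x y = trans (assoc x y y) (trans (cong (x ∙_) (elementary y)) (identityʳ x))

    select-xor : ∀ b c x → (if b xor c then x else ε) ≡ (if b then x else ε) ∙ (if c then x else ε)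
    select-xor true true x = sym (elementary x)
    select-xor true false x = sym (identityʳ x)
    select-xor false true x = sym (identityˡ x)
    select-xor false false x = sym (identityˡ ε)

    span-xor : ∀ {k} (B : Vec (Fin n) k) v w → span B (zipWith _xor_ v w) ≡ span B v ∙ span B w
    span-xor [] [] [] = sym (identityˡ ε)
    span-xor (x ∷ B) (b ∷ v) (c ∷ w) =
      trans (cong₂ _∙_ (select-xor b c x) (span-xor B v w)) (interchange _ _ (span B v) (span B w))

    extend : ∀ {k} {B : Vec (Fin n) k} {x} → SpanInjective B → (∀ v → span B v ≢ x) → SpanInjective (x ∷ B)
    extend {B = B} {x} injective x∉span {true ∷ v} {true ∷ w} eq = cong (true ∷_) (injective (∙-cancelˡ x _ _ eq))
    extend {B = B} {x} injective x∉span {false ∷ v} {false ∷ w} eq = cong (false ∷_) (injective (∙-cancelˡ ε _ _ eq))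
    extend {B = B} {x} injective x∉span {true ∷ v} {false ∷ w} eq = ⊥-elim (x∉span (zipWith _xor_ w v) (begin
      span B (zipWith _xor_ w v)      ≡⟨ span-xor B w v ⟩
      span B w ∙ span B v             ≡⟨ cong (_∙ span B v) (trans (sym (identityˡ _)) (sym eq)) ⟩
      x ∙ span B v ∙ span B v         ≡⟨ x∙y∙y≡x x (span B v) ⟩
      x                               ∎))
      where open ≡-Reasoning
    extend {B = B} {x} injective x∉span {false ∷ v} {true ∷ w} eq = ⊥-elim (x∉span (zipWith _xor_ v w) (begin
      span B (zipWith _xor_ v w)      ≡⟨ span-xor B v w ⟩
      span B v ∙ span B w             ≡⟨ cong (_∙ span B w) (trans (sym (identityˡ _)) eq) ⟩
      x ∙ span B w ∙ span B w         ≡⟨ x∙y∙y≡x x (span B w) ⟩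
      x                               ∎))
      where open ≡-Reasoning

    basis : ∃ λ k → Σ (Vec (Fin n) k) λ B → SpanInjective B × (∀ i → ∃ λ v → span B v ≡ i)
    basis = grow (suc n) [] (λ { {[]} {[]} _ → refl }) (ℕ.+-identityʳ (suc n))
      where
      grow : ∀ fuel {k} (B : Vec (Fin n) k) → SpanInjective B → fuel ℕ.+ k ≡ suc n →
             ∃ λ k → Σ (Vec (Fin n) k) λ B → SpanInjective B × (∀ i → ∃ λ v → span B v ≡ i)
      grow zero B injective k≡1+n = ⊥-elim (ℕ.<-irrefl refl (subst (ℕ._≤ n) k≡1+n (span-injective⇒≤ B injective)))
      grow (suc fuel) {k} B injective fuel+k≡1+n with all? (λ i → ∃-VecBool? k (λ v → span B v ≟ i))
      ... | yes surjective = k , B , injective , surjective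
      ... | no ¬surjective with ¬∀⟶∃¬ n _ (λ i → ∃-VecBool? k (λ v → span B v ≟ i)) ¬surjective
      ...   | x , x∉span =
        grow fuel (x ∷ B) (extend injective (λ v eq → x∉span (v , eq))) (trans (ℕ.+-suc fuel k) fuel+k≡1+n)

  balanced-witness : ∀ {h a} → h ≢ ε → h ∙ h ≡ ε → a ∙ a ≢ ε → Balanced ε (a ∙ h) h a
  balanced-witness {h} {a} h≢ε h²≡ε a²≢ε =
    balanced (distinct4 ε≢ah (h≢ε ∘ sym) ε≢a ah≢h ah≢a h≢a) (trans (identityˡ (a ∙ h)) (comm a h))
    where
    h≢a : h ≢ a
    h≢a refl = a²≢ε h²≡ε
    ε≢a : ε ≢ a
    ε≢a refl = a²≢ε (identityˡ ε)
    ε≢ah : ε ≢ a ∙ h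
    ε≢ah ε≡ah = h≢a (sym (∙-cancelʳ h a h (trans (sym ε≡ah) (sym h²≡ε))))
    ah≢h : a ∙ h ≢ h
    ah≢h ah≡h = ε≢a (sym (identityˡ-unique a h ah≡h))
    ah≢a : a ∙ h ≢ a
    ah≢a ah≡a = h≢ε (identityʳ-unique a h ah≡a)

-- The group law of G transported along the enumeration g to Fin n, where equality is decidable.
module IndexGroup {c ℓ} (G : AbelianGroup c ℓ) {n : ℕ} (g : Fin n → AbelianGroup.Carrier G)
  (enumeration : IsEnumeration G g) where

  open AbelianGroup G
    using (Carrier; _≈_; _∙_; ε; _⁻¹; setoid; ∙-cong; ∙-congˡ; ∙-congʳ; assoc; comm;
           identityˡ; identityʳ; inverseˡ; inverseʳ)
    renaming (refl to ≈-refl; reflexive to ≈-reflexive; sym to ≈-sym; trans to ≈-trans)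
  g-injective : ∀ {i j} → g i ≈ g j → i ≡ j
  g-injective = proj₁ enumeration _ _

  ι : Carrier → Fin n
  ι a = proj₁ (proj₂ enumeration a)

  g∘ι : ∀ a → g (ι a) ≈ a
  g∘ι a = proj₂ (proj₂ enumeration a)

  ι-cong : ∀ {a b} → a ≈ b → ι a ≡ ι b
  ι-cong {a} {b} a≈b = g-injective (≈-trans (g∘ι a) (≈-trans a≈b (≈-sym (g∘ι b))))

  ι∘g : ∀ i → ι (g i) ≡ i
  ι∘g i = g-injective (g∘ι (g i))

  infixl 7 _⊕_
  _⊕_ : Fin n → Fin n → Fin n
  i ⊕ j = ι (g i ∙ g j)

  𝟎 : Fin n
  𝟎 = ι ε

  ⊖_ : Fin n → Fin n
  ⊖ i = ι (g i ⁻¹)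

  g-homo : ∀ i j → g (i ⊕ j) ≈ g i ∙ g j
  g-homo i j = g∘ι (g i ∙ g j)

  ι-homo : ∀ a b → ι (a ∙ b) ≡ ι a ⊕ ι b
  ι-homo a b = ι-cong (∙-cong (≈-sym (g∘ι a)) (≈-sym (g∘ι b)))

  ⊕-assoc : ∀ i j k → i ⊕ j ⊕ k ≡ i ⊕ (j ⊕ k)
  ⊕-assoc i j k = ι-cong (begin
    g (i ⊕ j) ∙ g k        ≈⟨ ∙-congʳ (g-homo i j) ⟩
    g i ∙ g j ∙ g k        ≈⟨ assoc (g i) (g j) (g k) ⟩
    g i ∙ (g j ∙ g k)      ≈⟨ ∙-congˡ (g-homo j k) ⟨
    g i ∙ g (j ⊕ k)        ∎)
    where open import Relation.Binary.Reasoning.Setoid setoid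

  isAbelianGroup : IsAbelianGroup _≡_ _⊕_ 𝟎 ⊖_
  isAbelianGroup = record
    { isGroup = record
      { isMonoid = record
        { isSemigroup = record
          { isMagma = record { isEquivalence = isEquivalence ; ∙-cong = cong₂ _⊕_ }
          ; assoc = ⊕-assoc
          }
        ; identity = (λ i → trans (ι-cong (≈-trans (∙-congʳ (g∘ι ε)) (identityˡ (g i)))) (ι∘g i))
                   , (λ i → trans (ι-cong (≈-trans (∙-congˡ (g∘ι ε)) (identityʳ (g i)))) (ι∘g i))
        }
      ; inverse = (λ i → ι-cong (≈-trans (∙-congʳ (g∘ι (g i ⁻¹))) (inverseˡ (g i))))
                , (λ i → ι-cong (≈-trans (∙-congˡ (g∘ι (g i ⁻¹))) (inverseʳ (g i))))
      ; ⁻¹-cong = cong ⊖_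
      }
    ; comm = λ i j → ι-cong (comm (g i) (g j))
    }

  private module 𝔾 = FiniteAbelianGroup isAbelianGroup

  elementary⇒Z₂-power : (∀ i → i ⊕ i ≡ 𝟎) → ∃ λ ν → IsoToZ2Pow G ν
  elementary⇒Z₂-power elementary with 𝔾.basis elementary
  ... | ν , B , injective , surjective = ν , f , f-cong , f-homo , f-injective , f-surjective
    where
    f : Carrier → Vec Bool ν
    f a = proj₁ (surjective (ι a))
    span∘f : ∀ a → 𝔾.span B (f a) ≡ ι a
    span∘f a = proj₂ (surjective (ι a))
    f-cong : ∀ a b → a ≈ b → f a ≡ f b
    f-cong a b a≈b = cong (λ i → proj₁ (surjective i)) (ι-cong a≈b)
    f-homo : ∀ a b → f (a ∙ b) ≡ zipWith _xor_ (f a) (f b)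
    f-homo a b = injective (begin
      𝔾.span B (f (a ∙ b))                   ≡⟨ span∘f (a ∙ b) ⟩
      ι (a ∙ b)                              ≡⟨ ι-homo a b ⟩
      ι a ⊕ ι b                              ≡⟨ cong₂ _⊕_ (span∘f a) (span∘f b) ⟨
      𝔾.span B (f a) ⊕ 𝔾.span B (f b)        ≡⟨ 𝔾.span-xor elementary B (f a) (f b) ⟨
      𝔾.span B (zipWith _xor_ (f a) (f b))   ∎)
      where open ≡-Reasoning
    f-injective : ∀ a b → f a ≡ f b → a ≈ b
    f-injective a b fa≡fb = ≈-trans (≈-sym (g∘ι a)) (≈-trans (≈-reflexive (cong g ιa≡ιb)) (g∘ι b))
      where
      ιa≡ιb : ι a ≡ ι b
      ιa≡ιb = trans (sym (span∘f a)) (trans (cong (𝔾.span B) fa≡fb) (span∘f b))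
    f-surjective : ∀ v → ∃ λ a → f a ≡ v
    f-surjective v = g (𝔾.span B v) , injective (trans (span∘f (g (𝔾.span B v))) (ι∘g (𝔾.span B v)))

  ∃a⊕a≢𝟎 : (∀ ν → ¬ IsoToZ2Pow G ν) → ∃ λ i → i ⊕ i ≢ 𝟎
  ∃a⊕a≢𝟎 not-Z₂-power with any? (λ i → ¬? (i ⊕ i ≟ 𝟎))
  ... | yes witness = witness
  ... | no none = ⊥-elim (not-Z₂-power _ (proj₂ (elementary⇒Z₂-power
          (λ i → decidable-stable (i ⊕ i ≟ 𝟎) (λ i⊕i≢𝟎 → none (i , i⊕i≢𝟎))))))

module LinearCombination {c ℓ} (G : AbelianGroup c ℓ) where

  open AbelianGroup G
    using (Carrier; _≈_; _∙_; ε; _⁻¹; setoid; ∙-cong; ∙-congˡ; ∙-congʳ; ⁻¹-cong; assoc; comm;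
           identityˡ; identityʳ; inverseʳ; commutativeSemigroup)
    renaming (refl to ≈-refl; reflexive to ≈-reflexive; sym to ≈-sym; trans to ≈-trans)
  open import Algebra.Properties.AbelianGroup G using (ε⁻¹≈ε; ⁻¹-involutive; ⁻¹-∙-comm)
  open import Algebra.Properties.CommutativeSemigroup commutativeSemigroup using (interchange)
  open import Relation.Binary.Reasoning.Setoid setoid

  natMul-homo-+ : ∀ m k x → natMul G (m ℕ.+ k) x ≈ natMul G m x ∙ natMul G k x
  natMul-homo-+ zero k x = ≈-sym (identityˡ _)
  natMul-homo-+ (suc m) k x = ≈-trans (∙-congˡ (natMul-homo-+ m k x)) (≈-sym (assoc x _ _))

  intMul-⊖ : ∀ m k x → intMul G (m ⊖ℕ k) x ≈ natMul G m x ∙ natMul G k x ⁻¹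
  intMul-⊖ m zero x = ≈-sym (≈-trans (∙-congˡ ε⁻¹≈ε) (identityʳ _))
  intMul-⊖ zero (suc k) x = ≈-sym (identityˡ _)
  intMul-⊖ (suc m) (suc k) x = begin
    intMul G (suc m ⊖ℕ suc k) x                 ≡⟨ cong (λ i → intMul G i x) (ℤ.[1+m]⊖[1+n]≡m⊖n m k) ⟩
    intMul G (m ⊖ℕ k) x                         ≈⟨ intMul-⊖ m k x ⟩
    natMul G m x ∙ natMul G k x ⁻¹             ≈⟨ identityˡ _ ⟨
    ε ∙ (natMul G m x ∙ natMul G k x ⁻¹)       ≈⟨ ∙-congʳ (inverseʳ x) ⟨
    x ∙ x ⁻¹ ∙ (natMul G m x ∙ natMul G k x ⁻¹) ≈⟨ interchange x (x ⁻¹) _ _ ⟩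
    x ∙ natMul G m x ∙ (x ⁻¹ ∙ natMul G k x ⁻¹) ≈⟨ ∙-congˡ (⁻¹-∙-comm x _) ⟩
    natMul G (suc m) x ∙ natMul G (suc k) x ⁻¹ ∎

  intMul-homo-+ : ∀ i j x → intMul G (i + j) x ≈ intMul G i x ∙ intMul G j x
  intMul-homo-+ (+ m) (+ k) x = natMul-homo-+ m k x
  intMul-homo-+ (+ m) -[1+ k ] x = intMul-⊖ m (suc k) x
  intMul-homo-+ -[1+ m ] (+ k) x = ≈-trans (intMul-⊖ k (suc m) x) (comm _ _)
  intMul-homo-+ -[1+ m ] -[1+ k ] x = begin
    natMul G (suc (suc (m ℕ.+ k))) x ⁻¹              ≡⟨ cong (λ l → natMul G (suc l) x ⁻¹) (ℕ.+-suc m k) ⟨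
    natMul G (suc m ℕ.+ suc k) x ⁻¹                  ≈⟨ ⁻¹-cong (natMul-homo-+ (suc m) (suc k) x) ⟩
    (natMul G (suc m) x ∙ natMul G (suc k) x) ⁻¹      ≈⟨ ⁻¹-∙-comm _ _ ⟨
    natMul G (suc m) x ⁻¹ ∙ natMul G (suc k) x ⁻¹    ∎

  intMul-neg : ∀ i x → intMul G (- i) x ≈ intMul G i x ⁻¹
  intMul-neg (+ zero) x = ≈-sym ε⁻¹≈ε
  intMul-neg (+ suc k) x = ≈-refl
  intMul-neg -[1+ k ] x = ≈-sym (⁻¹-involutive _)

  natMul-≈ε : ∀ k {a} → a ≈ ε → natMul G k a ≈ ε
  natMul-≈ε zero a≈ε = ≈-refl
  natMul-≈ε (suc k) a≈ε = ≈-trans (∙-cong a≈ε (natMul-≈ε k a≈ε)) (identityˡ ε)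

  intMul-≈ε : ∀ i {a} → a ≈ ε → intMul G i a ≈ ε
  intMul-≈ε (+ k) a≈ε = natMul-≈ε k a≈ε
  intMul-≈ε -[1+ k ] a≈ε = ≈-trans (⁻¹-cong (natMul-≈ε (suc k) a≈ε)) ε⁻¹≈ε

  lincomb : ∀ {n} → (Fin n → Carrier) → (Fin n → ℤ) → Carrier
  lincomb g x = gsum G (λ k → intMul G (x k) (g k))

  gsum-cong : ∀ {n} {f h : Fin n → Carrier} → (∀ k → f k ≈ h k) → gsum G f ≈ gsum G h
  gsum-cong {zero} f≈h = ≈-refl
  gsum-cong {suc n} f≈h = ∙-cong (f≈h zero) (gsum-cong (f≈h ∘ suc))

  gsum-ε : ∀ n → gsum G {n} (λ _ → ε) ≈ ε
  gsum-ε zero = ≈-refl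
  gsum-ε (suc n) = ≈-trans (identityˡ _) (gsum-ε n)

  gsum-∙ : ∀ {n} (f h : Fin n → Carrier) → gsum G (λ k → f k ∙ h k) ≈ gsum G f ∙ gsum G h
  gsum-∙ {zero} f h = ≈-sym (identityˡ ε)
  gsum-∙ {suc n} f h = ≈-trans (∙-congˡ (gsum-∙ (f ∘ suc) (h ∘ suc))) (interchange _ _ _ _)

  gsum-⁻¹ : ∀ {n} (f : Fin n → Carrier) → gsum G (λ k → f k ⁻¹) ≈ gsum G f ⁻¹
  gsum-⁻¹ {zero} f = ≈-sym ε⁻¹≈ε
  gsum-⁻¹ {suc n} f = ≈-trans (∙-congˡ (gsum-⁻¹ (f ∘ suc))) (⁻¹-∙-comm _ _)

  module _ {n : ℕ} (g : Fin n → Carrier) where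

    lincomb-cong : ∀ {x y} → (∀ k → x k ≡ y k) → lincomb g x ≈ lincomb g y
    lincomb-cong x≗y = gsum-cong (λ k → ≈-reflexive (cong (λ i → intMul G i (g k)) (x≗y k)))

    lincomb-homo-+ : ∀ x y → lincomb g (λ k → x k + y k) ≈ lincomb g x ∙ lincomb g y
    lincomb-homo-+ x y = ≈-trans (gsum-cong (λ k → intMul-homo-+ (x k) (y k) (g k)))
      (gsum-∙ (λ k → intMul G (x k) (g k)) (λ k → intMul G (y k) (g k)))

    lincomb-neg : ∀ x → lincomb g (λ k → - x k) ≈ lincomb g x ⁻¹
    lincomb-neg x = ≈-trans (gsum-cong (λ k → intMul-neg (x k) (g k))) (gsum-⁻¹ (λ k → intMul G (x k) (g k)))

    lincomb-homo-- : ∀ x y → lincomb g (λ k → x k - y k) ≈ lincomb g x ∙ lincomb g y ⁻¹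
    lincomb-homo-- x y = ≈-trans (lincomb-homo-+ x (λ k → - y k)) (∙-congˡ (lincomb-neg y))

  lincomb-tail : ∀ {n} (g : Fin (suc n) → Carrier) → g zero ≈ ε → ∀ x →
           lincomb g x ≈ gsum G (λ j → intMul G (x (suc j)) (g (suc j)))
  lincomb-tail g g0≈ε x = ≈-trans (∙-congʳ (intMul-≈ε (x zero) g0≈ε)) (identityˡ _)

  lincomb-δ : ∀ {n} (g : Fin n → Carrier) a → lincomb g (δ a) ≈ g a
  lincomb-δ {suc n} g zero = ≈-trans (∙-cong (identityʳ (g zero)) (gsum-ε n)) (identityʳ (g zero))
  lincomb-δ {suc n} g (suc a) = ≈-trans (identityˡ _) (lincomb-δ (g ∘ suc) a)

  lincomb-quad : ∀ {n} (g : Fin n → Carrier) a b c d → lincomb g (quad a b c d) ≈ (g a ∙ g b) ∙ (g c ∙ g d) ⁻¹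
  lincomb-quad g a b c d = begin
    lincomb g (quad a b c d)
      ≈⟨ lincomb-homo-- g (λ k → δ a k + δ b k - δ c k) (δ d) ⟩
    lincomb g (λ k → δ a k + δ b k - δ c k) ∙ lincomb g (δ d) ⁻¹
      ≈⟨ ∙-congʳ (lincomb-homo-- g (λ k → δ a k + δ b k) (δ c)) ⟩
    lincomb g (λ k → δ a k + δ b k) ∙ lincomb g (δ c) ⁻¹ ∙ lincomb g (δ d) ⁻¹
      ≈⟨ ∙-congʳ (∙-congʳ (lincomb-homo-+ g (δ a) (δ b))) ⟩
    lincomb g (δ a) ∙ lincomb g (δ b) ∙ lincomb g (δ c) ⁻¹ ∙ lincomb g (δ d) ⁻¹
      ≈⟨ ∙-cong (∙-cong (∙-cong (lincomb-δ g a) (lincomb-δ g b)) (⁻¹-cong (lincomb-δ g c))) (⁻¹-cong (lincomb-δ g d)) ⟩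
    g a ∙ g b ∙ g c ⁻¹ ∙ g d ⁻¹
      ≈⟨ assoc _ _ _ ⟩
    g a ∙ g b ∙ (g c ⁻¹ ∙ g d ⁻¹)
      ≈⟨ ∙-congˡ (⁻¹-∙-comm (g c) (g d)) ⟩
    (g a ∙ g b) ∙ (g c ∙ g d) ⁻¹
      ∎

  lincomb-difference : ∀ {n} (g : Fin n → Carrier) a c → lincomb g (λ k → δ a k - δ c k) ≈ g a ∙ g c ⁻¹
  lincomb-difference g a c = ≈-trans (lincomb-homo-- g (δ a) (δ c)) (∙-cong (lincomb-δ g a) (⁻¹-cong (lincomb-δ g c)))

module Lattice {c ℓ} (G : AbelianGroup c ℓ) {m : ℕ} (g : Fin (suc m) → AbelianGroup.Carrier G)
  (enumeration : IsEnumeration G g) (g0≈ε : AbelianGroup._≈_ G (g zero) (AbelianGroup.ε G)) where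

  open AbelianGroup G using (_≈_; _∙_; ε; _⁻¹)
    renaming (reflexive to ≈-reflexive; sym to ≈-sym; trans to ≈-trans)
  open import Algebra.Properties.AbelianGroup G using (x∙y⁻¹≈ε⇒x≈y; x≈y⇒x∙y⁻¹≈ε)
  open IndexGroup G g enumeration public
  open FiniteAbelianGroup isAbelianGroup public
  open LinearCombination G

  L : Vec ℤ (suc m) → Set ℓ
  L = InLG G g

  L⇒lincomb≈ε : ∀ {x} → L x → lincomb g (lookup x) ≈ ε
  L⇒lincomb≈ε {x} (_ , tail≈ε) = ≈-trans (lincomb-tail g g0≈ε (lookup x)) tail≈ε

  lookup-quadVec : ∀ (a b c d i : Fin (suc m)) → lookup (quadVec a b c d) i ≡ quad a b c d i
  lookup-quadVec a b c d = lookup∘tabulate (quad a b c d)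

  g-relation : ∀ {a b c d} → a ⊕ b ≡ c ⊕ d → g a ∙ g b ≈ g c ∙ g d
  g-relation {a} {b} {c} {d} ab≡cd = ≈-trans (≈-sym (g-homo a b)) (≈-trans (≈-reflexive (cong g ab≡cd)) (g-homo c d))

  balanced⇒L : ∀ {a b c d} → Balanced a b c d → L (quadVec a b c d)
  balanced⇒L {a} {b} {c} {d} (balanced _ ab≡cd) =
    trans (sumV≡sum (quadVec a b c d)) (trans (sum-cong-≗ (lookup-quadVec a b c d)) (∑-quad a b c d)) ,
    ≈-trans (≈-sym (lincomb-tail g g0≈ε (lookup (quadVec a b c d))))
      (≈-trans (lincomb-cong g (lookup-quadVec a b c d))
        (≈-trans (lincomb-quad g a b c d) (x≈y⇒x∙y⁻¹≈ε (g-relation ab≡cd))))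

  quadVec-nonzero : ∀ {a b c d} → Distinct4 a b c d → ¬ IsZeroVec (quadVec a b c d)
  quadVec-nonzero {a} D zero-vec = case trans (sym (trans (lookup-quadVec _ _ _ _ a) (quad-at-a D))) (zero-vec a) of λ ()

  norm²-quadVec : ∀ {a b c d} → Distinct4 a b c d → norm² (quadVec a b c d) ≡ + 4
  norm²-quadVec {a} {b} {c} {d} D = trans (dot≡sum (quadVec a b c d) (quadVec a b c d))
    (trans (sum-cong-≗ (λ i → cong₂ _*_ (lookup-quadVec a b c d i) (lookup-quadVec a b c d i))) (‖quad‖² D))

  norm²-QuadRep : ∀ {x} → QuadRep x → norm² x ≡ + 4
  norm²-QuadRep (quadRep (balanced D _) refl) = norm²-quadVec D

  classify : ∀ x → L x → ¬ IsZeroVec x → norm² x ≤ + 4 → QuadRep x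
  classify x x∈L x≢0 ‖x‖²≤4 with ¬∀⟶∃¬ _ _ (λ i → lookup x i ℤ.≟ 0ℤ) x≢0
  ... | i , xᵢ≢0
    with small-shape (lookup x) (trans (sym (sumV≡sum x)) (proj₁ x∈L)) (subst (_≤ + 4) (dot≡sum x x) ‖x‖²≤4) {i} xᵢ≢0
  ...   | difference {a} {c} a≢c x≗δa-δc = ⊥-elim (a≢c (g-injective (x∙y⁻¹≈ε⇒x≈y (g a) (g c)
            (≈-trans (≈-sym (lincomb-difference g a c))
              (≈-trans (≈-sym (lincomb-cong g x≗δa-δc)) (L⇒lincomb≈ε {x} x∈L))))))
  ...   | quadruple {a} {b} {c} {d} D x≗quad = quadRep (balanced D (ι-cong gab≈gcd))
            (trans (sym (tabulate∘lookup x)) (tabulate-cong x≗quad))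
    where
    gab≈gcd : g a ∙ g b ≈ g c ∙ g d
    gab≈gcd = x∙y⁻¹≈ε⇒x≈y _ _
      (≈-trans (≈-sym (lincomb-quad g a b c d)) (≈-trans (≈-sym (lincomb-cong g x≗quad)) (L⇒lincomb≈ε {x} x∈L)))

  minimal-norm²≡4 : 2 ∣ suc m → (∃ λ a → a ⊕ a ≢ 𝟎) → ∀ {M} → IsMinNorm² L M → M ≡ + 4
  minimal-norm²≡4 2∣n (a , a²≢𝟎) {M} ((x₀ , x₀∈L , x₀≢0 , ‖x₀‖²≡M) , M≤) with even⇒∃involution 2∣n
  ... | h , h≢𝟎 , h²≡𝟎 =
    trans (sym ‖x₀‖²≡M) (norm²-QuadRep (classify x₀ x₀∈L x₀≢0 (subst (_≤ + 4) (sym ‖x₀‖²≡M) M≤4)))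
    where
    witness : Balanced 𝟎 (a ⊕ h) h a
    witness = balanced-witness h≢𝟎 h²≡𝟎 a²≢𝟎
    M≤4 : M ≤ + 4
    M≤4 = subst (M ≤_) (norm²-quadVec (Balanced.distinct witness))
            (M≤ _ (balanced⇒L witness) (quadVec-nonzero (Balanced.distinct witness)))

  module MinimalVectors {M : ℤ} {S : List (Vec ℤ (suc m))} (M≡4 : M ≡ + 4) (enumerates : EnumeratesMinVecs L M S) where

    s : Fin (length S) → Vec ℤ (suc m)
    s = List.lookup S

    s-minimal : ∀ k → IsMinVec L M (s k)
    s-minimal k = Equivalence.to (proj₂ enumerates (s k)) (∈-lookup k)

    s-quad : ∀ k → QuadRep (s k)
    s-quad k = let (sₖ∈L , sₖ≢0 , ‖sₖ‖²≡M) = s-minimal k in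
      classify (s k) sₖ∈L sₖ≢0 (ℤ.≤-reflexive (trans ‖sₖ‖²≡M M≡4))

    quad-s : ∀ {a b c d} → Balanced a b c d → ∃ λ k → s k ≡ quadVec a b c d
    quad-s B = let q∈S = Equivalence.from (proj₂ enumerates _) (balanced⇒L B , quadVec-nonzero (Balanced.distinct B) ,
                                                                trans (norm²-quadVec (Balanced.distinct B)) (sym M≡4))
               in Any.index q∈S , sym (lookup-index q∈S)

    balancedMoment≡4∑ : ∀ t → balancedMoment t ≡ + 4 * sum (λ k → lookup (s k) t * lookup (s k) 𝟎)
    balancedMoment≡4∑ t = trans
      (∑⁴-cong (λ a b c d → trans (ℤ.*-assoc (β a b c d) (quad a b c d t) (quad a b c d 𝟎))
        (cong (β a b c d *_) (sym (cong₂ _*_ (lookup-quadVec a b c d t) (lookup-quadVec a b c d 𝟎))))))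
      (sym (∑-via-quadruples s (lookup-injective (proj₁ enumerates)) s-quad quad-s (λ v → lookup v t * lookup v 𝟎)))

    module _ .{{_ : ℕ.NonZero m}} (eutactic : ∀ y → SumZero y →
        + m * sumL (List.map (λ x → dot x y * dot x y) S) ≡ M * + length S * dot y y) where

      eutactic-differences : ∀ {t i} → t ≢ i →
        + m * sum (λ k → (lookup (s k) t - lookup (s k) i) * (lookup (s k) t - lookup (s k) i)) ≡ M * + length S * + 2
      eutactic-differences {t} {i} t≢i = begin
        + m * sum (λ k → (lookup (s k) t - lookup (s k) i) * (lookup (s k) t - lookup (s k) i))
          ≡⟨ cong (+ m *_) (sum-cong-≗ (λ k → cong (λ v → v * v) (dot-differenceVec (s k) t i))) ⟨
        + m * sum (λ k → dot (s k) y * dot (s k) y)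
          ≡⟨ cong (+ m *_) (sumL-map≡sum (λ x → dot x y * dot x y) S) ⟨
        + m * sumL (List.map (λ x → dot x y * dot x y) S)
          ≡⟨ eutactic y (sumV-differenceVec t i) ⟩
        M * + length S * dot y y
          ≡⟨ cong (M * + length S *_) (norm²-differenceVec t≢i) ⟩
        M * + length S * + 2
          ∎
        where
        open ≡-Reasoning
        y : Vec ℤ (suc m)
        y = differenceVec t i

      open Design (λ k → lookup (s k))
        (λ k → trans (sym (sumV≡sum (s k))) (proj₁ (proj₁ (s-minimal k))))
        (λ k → trans (sym (dot≡sum (s k) (s k))) (trans (proj₂ (proj₂ (s-minimal k))) M≡4))
        (M * + length S * + 2) eutactic-differences

      balancedMoment-constant : ∀ {t u} → t ≢ 𝟎 → u ≢ 𝟎 → balancedMoment t ≡ balancedMoment u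
      balancedMoment-constant {t} {u} t≢𝟎 u≢𝟎 = begin
        balancedMoment t                                     ≡⟨ balancedMoment≡4∑ t ⟩
        + 4 * sum (λ k → lookup (s k) t * lookup (s k) 𝟎)    ≡⟨ cong (+ 4 *_) (correlation-constant t≢𝟎 u≢𝟎) ⟩
        + 4 * sum (λ k → lookup (s k) u * lookup (s k) 𝟎)    ≡⟨ balancedMoment≡4∑ u ⟨
        balancedMoment u                                     ∎
        where open ≡-Reasoning

theorem2p2 : ∀ {c ℓ} (G : AbelianGroup c ℓ) (m : ℕ)
    (g : Fin (suc m) → AbelianGroup.Carrier G) →
    IsEnumeration G g →
    AbelianGroup._≈_ G (g zero) (AbelianGroup.ε G) →
    2 ∣ suc m →
    4 ℕ.≤ suc m →
    (∀ ν → ¬ IsoToZ2Pow G ν) →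
    ¬ StronglyEutactic (InLG G g) SumZero m
theorem2p2 G m g enumeration g0≈ε 2∣n 4≤n not-Z₂-power (M , S , minimal , enumerates , eutactic) =
  balancedMoment-nonconstant 2∣n a⊕a≢𝟎 (balancedMoment-constant eutactic)
  where
  open Lattice G g enumeration g0≈ε
  a⊕a≢𝟎 : ∃ λ a → a ⊕ a ≢ 𝟎
  a⊕a≢𝟎 = ∃a⊕a≢𝟎 not-Z₂-power
  open MinimalVectors (minimal-norm²≡4 2∣n a⊕a≢𝟎 minimal) enumerates
  instance
    m≢0 : ℕ.NonZero m
    m≢0 = ℕ.>-nonZero (ℕ.<-≤-trans (s≤s z≤n) (ℕ.s≤s⁻¹ 4≤n))
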